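{- Let $G$ be a finite simple graph and let $u,v$ be vertices of $G$ such that $v$ is domination covered by $u$, i.e. $u\in N_G(v)$ and $N_G[v]\subseteq N_G[u]$. Then \begin{align*} J(G) &= (x+y)J(G-v) - y(x+y)J(G-u-v) + yJ(G-u)\\ &\quad +(1-y)\bigl(J(G\backslash v) - yJ((G-u)\backslash v) - xJ((G-v)\backslash u)\bigr)\\ &\quad - x(1-y)y^{|N_G(u)|-1}J(G-N_G[u]). \end{align*}
   Context: For a finite simple graph $G$ and $W\subseteq V(G)$, $N_G[W]$ is the set of vertices that are in $W$ or adjacent to a vertex of $W$, and $N_G(W):=N_G[W]\setminus W$; for a vertex $a$, $N_G(a)$ is the set of neighbours of $a$ and $N_G[a]=N_G(a)\cup\{a\}$. The bivariate domination polynomial is $J(G;x,y)=J(G):=\sum_{W\subseteq V(G)} x^{|W|}y^{|N_G(W)|}$ (the graph with no vertices has $J=1$). For $X\subseteq V(G)$, $G-X$ is obtained by deleting the vertices of $X$ (and $G-u-v$ deletes both $u$ and $v$). For a graph $H$ and vertex $a$ of $H$, the vertex contraction $H\backslash a$ is the graph obtained from $H$ by adding edges between all pairs of vertices of $N_H(a)$ and then deleting $a$. -}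

module Defs where

open import Level using (Level)
open import Data.Nat using (ℕ; zero; suc)
open import Data.Bool using (Bool; true; false; _∧_; _∨_; not; if_then_else_)
open import Data.Bool.Properties using (∧-comm; ∨-comm)
open import Data.Fin using (Fin; zero; suc; _≟_)
open import Data.Fin.Properties using (≡-isDecEquivalence)
open import Data.List using (List; []; _∷_; _++_; map; foldr)
open import Relation.Nullary.Decidable using (⌊_⌋; yes; no)
open import Relation.Binary.PropositionalEquality using (_≡_; refl; sym; cong; cong₂; trans)
open import Algebra.Bundles using (CommutativeRing)

_==_ : ∀ {n} → Fin n → Fin n → Bool
i == j = ⌊ i ≟ j ⌋

==-refl : ∀ {n} (i : Fin n) → (i == i) ≡ true
==-refl i with i ≟ i
... | yes _ = refl
... | no ¬p = Data.Empty.⊥-elim (¬p refl)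
  where import Data.Empty

==-sym : ∀ {n} (i j : Fin n) → (i == j) ≡ (j == i)
==-sym i j with i ≟ j | j ≟ i
... | yes _ | yes _ = refl
... | no _ | no _ = refl
... | yes p | no ¬q = Data.Empty.⊥-elim (¬q (sym p))
  where import Data.Empty
... | no ¬p | yes q = Data.Empty.⊥-elim (¬p (sym q))
  where import Data.Empty

-- A finite simple graph: vertex set V ⊆ Fin n (as a Boolean predicate) and a
-- symmetric irreflexive adjacency relation on Fin n; only edges between
-- vertices of V are edges of the graph.
record Graph (n : ℕ) : Set where
  field
    V     : Fin n → Bool
    adj   : Fin n → Fin n → Bool
    adj-sym   : ∀ i j → adj i j ≡ adj j i
    adj-irrefl : ∀ i → adj i i ≡ false
open Graph public

E : ∀ {n} → Graph n → Fin n → Fin n → Bool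
E G i j = V G i ∧ V G j ∧ adj G i j

_─_ : ∀ {n} → Graph n → (Fin n → Bool) → Graph n
G ─ X = record
  { V = λ z → V G z ∧ not (X z)
  ; adj = adj G
  ; adj-sym = adj-sym G
  ; adj-irrefl = adj-irrefl G }

⟦_⟧ : ∀ {n} → Fin n → (Fin n → Bool)
⟦ a ⟧ z = z == a

N[_]_ : ∀ {n} → Fin n → Graph n → (Fin n → Bool)
(N[ a ] G) z = (V G z ∧ (z == a)) ∨ E G a z

_∖_ : ∀ {n} → Graph n → Fin n → Graph n
H ∖ a = record
  { V = λ z → V H z ∧ not (z == a)
  ; adj = adj'
  ; adj-sym = sym'
  ; adj-irrefl = irr }
  where
  adj' : _ → _ → Bool
  adj' i j = adj H i j ∨ (not (i == j) ∧ (E H a i ∧ E H a j))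
  sym' : ∀ i j → adj' i j ≡ adj' j i
  sym' i j = cong₂ _∨_ (adj-sym H i j)
               (cong₂ _∧_ (cong not (==-sym i j)) (∧-comm (E H a i) (E H a j)))
  irr : ∀ i → adj' i i ≡ false
  irr i rewrite adj-irrefl H i | ==-refl i = refl

subsets : (n : ℕ) → List (Fin n → Bool)
subsets zero = (λ ()) ∷ []
subsets (suc n) = map (λ W → ext false W) (subsets n) ++ map (λ W → ext true W) (subsets n)
  where
  ext : Bool → (Fin n → Bool) → Fin (suc n) → Bool
  ext b W zero = b
  ext b W (suc i) = W i

count : (n : ℕ) → (Fin n → Bool) → ℕ
count zero P = zero
count (suc n) P = (if P zero then suc else (λ k → k)) (count n (λ i → P (suc i)))

anyF : (n : ℕ) → (Fin n → Bool) → Bool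
anyF zero P = false
anyF (suc n) P = P zero ∨ anyF n (λ i → P (suc i))

allF : (n : ℕ) → (Fin n → Bool) → Bool
allF zero P = true
allF (suc n) P = P zero ∧ allF n (λ i → P (suc i))

Nbhd : ∀ {n} → Graph n → (Fin n → Bool) → (Fin n → Bool)
Nbhd {n} G W z = V G z ∧ not (W z) ∧ anyF n (λ w → W w ∧ E G w z)

deg : ∀ {n} → Graph n → Fin n → ℕ
deg {n} G a = count n (λ z → E G a z)

module _ {c ℓ : Level} (R : CommutativeRing c ℓ) where
  open CommutativeRing R

  pow : Carrier → ℕ → Carrier
  pow a zero = 1#
  pow a (suc k) = a * pow a k

  J : ∀ {n} → Graph n → Carrier → Carrier → Carrier
  J {n} G x y =
    foldr (λ W acc →
             (if allF n (λ z → not (W z) ∨ V G z)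
              then pow x (count n W) * pow y (count n (Nbhd G W))
              else 0#) + acc)
          0# (subsets n)

module Submission where

open import Defs
open import Level using (Level)
open import Data.Nat using (ℕ; _∸_)
open import Data.Bool using (true)
open import Data.Fin using (Fin)
open import Data.Sum using (_⊎_)
open import Relation.Binary.PropositionalEquality using (_≡_)
open import Algebra.Bundles using (CommutativeRing)

-- J(H) = Σ_W x^|W| y^|N_H(W)| is a sum over all
-- W ⊆ Fin n (terms with W ⊄ V(H) vanish), so both sides of the recurrence are
-- sums over one index set; as the right-hand side is linear in the seven J's,
-- it suffices to prove it on each fibre {W, W+u, W+v, W+u+v} with u, v ∉ W.
-- Fibres meeting Fin n ∖ V(G) contribute nothing.  For W ⊆ V(G) ∖ {u, v} the
-- 32 terms are determined by |W|, by whether W is adjacent to u and to v, and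
-- by the sizes of the parts of N(W), N(W) ∪ N(u), N(W) ∪ N(v), N(W) ∖ N(u)
-- away from W ∪ {u, v}; domination (N(W) ∋ v ⇒ N(W) ∋ u, and N(v) ⊆ N[u])
-- makes the remaining identity pure ring arithmetic.

module FiniteSets where

  open import Data.Nat using (zero; suc; _+_)
  open import Data.Nat.Properties using (+-suc; +-assoc; +-comm)
  open import Data.Bool using (Bool; true; false; _∧_; _∨_; if_then_else_)
  open import Data.Bool.Properties using (∨-zeroʳ; ∨-identityʳ; ∧-zeroʳ; ∧-identityʳ)
  open import Data.Fin using (zero; suc; _≟_)
  open import Data.Product using (∃; _,_)
  open import Data.Empty using (⊥-elim)
  open import Relation.Nullary using (¬_; yes; no)
  open import Relation.Binary.PropositionalEquality

  Subset : ℕ → Set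
  Subset n = Fin n → Bool

  _[_≔_] : ∀ {n} → Subset n → Fin n → Bool → Subset n
  (P [ p ≔ c ]) z = if z == p then c else P z

  bit : Bool → ℕ
  bit true  = 1
  bit false = 0

  ==⇒≡ : ∀ {n} {i j : Fin n} → (i == j) ≡ true → i ≡ j
  ==⇒≡ {i = i} {j} h with i ≟ j
  ... | yes i≡j = i≡j

  ≢⇒== : ∀ {n} {i j : Fin n} → ¬ i ≡ j → (i == j) ≡ false
  ≢⇒== {i = i} {j} i≢j with i ≟ j
  ... | yes i≡j = ⊥-elim (i≢j i≡j)
  ... | no _    = refl

  suc-== : ∀ {n} (i j : Fin n) → (suc i == suc j) ≡ (i == j)
  suc-== i j with i ≟ j
  ... | yes refl = refl
  ... | no _     = refl

  separated : ∀ {n} {P : Subset n} {i j} → P i ≡ true → P j ≡ false → ¬ i ≡ j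
  separated Pi Pj refl with trans (sym Pi) Pj
  ... | ()

  update-≢ : ∀ {n} (P : Subset n) p c z → ¬ z ≡ p → (P [ p ≔ c ]) z ≡ P z
  update-≢ P p c z z≢p = cong (if_then c else P z) (≢⇒== z≢p)

  update-≡ : ∀ {n} (P : Subset n) p c → (P [ p ≔ c ]) p ≡ c
  update-≡ P p c = cong (if_then c else P p) (==-refl p)

  count-cong : ∀ n {P Q : Subset n} → P ≗ Q → count n P ≡ count n Q
  count-cong zero    P≗Q = refl
  count-cong (suc n) {P} {Q} P≗Q rewrite P≗Q zero =
    cong (if Q zero then suc else (λ k → k)) (count-cong n (λ z → P≗Q (suc z)))

  anyF-cong : ∀ n {P Q : Subset n} → P ≗ Q → anyF n P ≡ anyF n Q
  anyF-cong zero    P≗Q = refl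
  anyF-cong (suc n) {P} {Q} P≗Q rewrite P≗Q zero = cong (Q zero ∨_) (anyF-cong n (λ z → P≗Q (suc z)))

  allF-cong : ∀ n {P Q : Subset n} → P ≗ Q → allF n P ≡ allF n Q
  allF-cong zero    P≗Q = refl
  allF-cong (suc n) {P} {Q} P≗Q rewrite P≗Q zero = cong (Q zero ∧_) (allF-cong n (λ z → P≗Q (suc z)))

  count-step : ∀ c m → (if c then suc else (λ k → k)) m ≡ bit c + m
  count-step true  m = refl
  count-step false m = refl

  count-update : ∀ n (P : Subset n) p c → P p ≡ false → count n (P [ p ≔ c ]) ≡ bit c + count n P
  count-update (suc n) P zero c Pp rewrite Pp = count-step c (count n (λ i → P (suc i)))
  count-update (suc n) P (suc p) c Pp
    rewrite count-cong n {λ i → (P [ suc p ≔ c ]) (suc i)} {(λ i → P (suc i)) [ p ≔ c ]}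
              (λ i → cong (if_then c else P (suc i)) (suc-== i p))
          | count-update n (λ i → P (suc i)) p c Pp
          | count-step (P zero) (bit c + count n (λ i → P (suc i)))
          | count-step (P zero) (count n (λ i → P (suc i)))
          | sym (+-assoc (bit (P zero)) (bit c) (count n (λ i → P (suc i))))
          | +-comm (bit (P zero)) (bit c) = +-assoc (bit c) (bit (P zero)) _

  count-∨ : ∀ n (P Q : Subset n) → (∀ z → P z ∧ Q z ≡ false) →
            count n (λ z → P z ∨ Q z) ≡ count n P + count n Q
  count-∨ zero    P Q disj = refl
  count-∨ (suc n) P Q disj with P zero | Q zero | disj zero
  ... | true  | false | _ = cong suc (count-∨ n _ _ (λ z → disj (suc z)))
  ... | false | true  | _ rewrite count-∨ n (λ i → P (suc i)) (λ i → Q (suc i)) (λ z → disj (suc z)) = sym (+-suc _ _)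
  ... | false | false | _ = count-∨ n _ _ (λ z → disj (suc z))

  anyF-false : ∀ n → anyF n (λ _ → false) ≡ false
  anyF-false zero    = refl
  anyF-false (suc n) = anyF-false n

  anyF-∨ : ∀ n (P Q : Subset n) → anyF n (λ w → P w ∨ Q w) ≡ anyF n P ∨ anyF n Q
  anyF-∨ zero    P Q = refl
  anyF-∨ (suc n) P Q rewrite anyF-∨ n (λ w → P (suc w)) (λ w → Q (suc w)) = interchange (P zero) (Q zero) _ _
    where
    interchange : ∀ a b c d → (a ∨ b) ∨ (c ∨ d) ≡ (a ∨ c) ∨ (b ∨ d)
    interchange true  b     c d = refl
    interchange false true  c d = sym (∨-zeroʳ c)
    interchange false false c d = refl

  anyF-∧ʳ : ∀ n (P : Subset n) c → anyF n (λ w → P w ∧ c) ≡ anyF n P ∧ c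
  anyF-∧ʳ n P true  = trans (anyF-cong n (λ w → ∧-identityʳ (P w))) (sym (∧-identityʳ (anyF n P)))
  anyF-∧ʳ n P false = trans (anyF-cong n (λ w → ∧-zeroʳ (P w))) (trans (anyF-false n) (sym (∧-zeroʳ (anyF n P))))

  anyF-∧ˡ : ∀ n (P : Subset n) c → anyF n (λ w → c ∧ P w) ≡ c ∧ anyF n P
  anyF-∧ˡ n P true  = refl
  anyF-∧ˡ n P false = anyF-false n

  anyF-point : ∀ n (p : Fin n) (Q : Subset n) → anyF n (λ w → (w == p) ∧ Q w) ≡ Q p
  anyF-point (suc n) zero    Q = trans (cong (Q zero ∨_) (anyF-false n)) (∨-identityʳ (Q zero))
  anyF-point (suc n) (suc p) Q =
    trans (anyF-cong n (λ w → cong (_∧ Q (suc w)) (suc-== w p))) (anyF-point n p (λ w → Q (suc w)))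

  anyF-intro : ∀ n (P : Subset n) z → P z ≡ true → anyF n P ≡ true
  anyF-intro (suc n) P zero    Pz rewrite Pz = refl
  anyF-intro (suc n) P (suc z) Pz rewrite anyF-intro n (λ w → P (suc w)) z Pz = ∨-zeroʳ (P zero)

  anyF-witness : ∀ n (P : Subset n) → anyF n P ≡ true → ∃ λ z → P z ≡ true
  anyF-witness (suc n) P h with P zero in P0
  ... | true  = zero , P0
  ... | false with anyF-witness n (λ w → P (suc w)) h
  ...   | z , Pz = suc z , Pz

  allF-intro : ∀ n (P : Subset n) → (∀ z → P z ≡ true) → allF n P ≡ true
  allF-intro zero    P h = refl
  allF-intro (suc n) P h rewrite h zero = allF-intro n (λ w → P (suc w)) (λ z → h (suc z))

  allF-elim : ∀ n (P : Subset n) → allF n P ≡ true → ∀ z → P z ≡ true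
  allF-elim (suc n) P h zero    with P zero
  ... | true = refl
  allF-elim (suc n) P h (suc z) with P zero
  ... | true = allF-elim n (λ w → P (suc w)) h z

  allF-refute : ∀ n (P : Subset n) z → P z ≡ false → allF n P ≡ false
  allF-refute (suc n) P zero    Pz rewrite Pz = refl
  allF-refute (suc n) P (suc z) Pz rewrite allF-refute n (λ w → P (suc w)) z Pz = ∧-zeroʳ (P zero)

  allF-counterexample : ∀ n (P : Subset n) → allF n P ≡ false → ∃ λ z → P z ≡ false
  allF-counterexample (suc n) P h with P zero in P0
  ... | false = zero , P0
  ... | true with allF-counterexample n (λ w → P (suc w)) h
  ...   | z , Pz = suc z , Pz

  anyF-update : ∀ n (P : Subset n) p c (Q : Subset n) → P p ≡ false →
                anyF n (λ w → (P [ p ≔ c ]) w ∧ Q w) ≡ (c ∧ Q p) ∨ anyF n (λ w → P w ∧ Q w)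
  anyF-update n P p c Q Pp =
    trans (anyF-cong n pointwise)
    (trans (anyF-∨ n _ _) (cong (_∨ anyF n (λ w → P w ∧ Q w)) (anyF-point n p (λ w → c ∧ Q w))))
    where
    pointwise : ∀ w → (P [ p ≔ c ]) w ∧ Q w ≡ ((w == p) ∧ (c ∧ Q w)) ∨ (P w ∧ Q w)
    pointwise w with w == p in w=p
    ... | true  rewrite ==⇒≡ w=p | Pp = sym (∨-identityʳ (c ∧ Q p))
    ... | false = refl

module Tautologies where

  open import Data.Nat using (zero; suc)
  open import Data.Bool using (Bool; true; false; _∧_; _∨_; not)
  open import Data.Vec using (Vec; []; _∷_)
  open import Relation.Binary.PropositionalEquality

  valid : (k : ℕ) → (Vec Bool k → Bool) → Bool
  valid zero    f = f []
  valid (suc k) f = valid k (λ ρ → f (true ∷ ρ)) ∧ valid k (λ ρ → f (false ∷ ρ))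

  valid-sound : ∀ k f → valid k f ≡ true → ∀ ρ → f ρ ≡ true
  valid-sound zero    f h []          = h
  valid-sound (suc k) f h (true ∷ ρ)  with valid k (λ ρ → f (true ∷ ρ)) in t
  ... | true = valid-sound k _ t ρ
  valid-sound (suc k) f h (false ∷ ρ) with valid k (λ ρ → f (true ∷ ρ))
  ... | true = valid-sound k _ h ρ

  _⇔_ : Bool → Bool → Bool
  true  ⇔ b = b
  false ⇔ b = not b

  entails : ∀ k (hyp lhs rhs : Vec Bool k → Bool) →
            valid k (λ ρ → not (hyp ρ) ∨ (lhs ρ ⇔ rhs ρ)) ≡ true →
            ∀ ρ → hyp ρ ≡ true → lhs ρ ≡ rhs ρ
  entails k hyp lhs rhs h ρ hρ = equiv (hyp ρ) (lhs ρ) (rhs ρ) (valid-sound k _ h ρ) hρ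
    where
    equiv : ∀ h l r → not h ∨ (l ⇔ r) ≡ true → h ≡ true → l ≡ r
    equiv true true  true  _ _ = refl
    equiv true false false _ _ = refl

module SubsetSums {c ℓ : Level} (R : CommutativeRing c ℓ) where

  open CommutativeRing R hiding (zero)
  open import Algebra.Properties.Ring ring using (-1*x≈-x)
  open import Algebra.Properties.CommutativeSemigroup +-commutativeSemigroup using (interchange)
  open import Data.Nat using (zero; suc)
  open import Data.Bool using (Bool; true; false; if_then_else_)
  open import Data.Fin using (zero; suc)
  open import Data.List using (List; []; _∷_; _++_; map; foldr)
  open import Data.List.Properties using (foldr-++; foldr-map)
  import Relation.Binary.PropositionalEquality as ≡
  open ≡ using (_≡_; _≗_)
  open FiniteSets using (Subset; _[_≔_]; suc-==)

  sumOver : ∀ {n} → List (Subset n) → (Subset n → Carrier) → Carrier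
  sumOver Ws f = foldr (λ W acc → f W + acc) 0# Ws

  Σ : ∀ {n} → (Subset n → Carrier) → Carrier
  Σ {n} = sumOver (subsets n)

  sumOver-cong : ∀ {n} {f g : Subset n → Carrier} Ws → (∀ W → f W ≈ g W) → sumOver Ws f ≈ sumOver Ws g
  sumOver-cong []       f≈g = refl
  sumOver-cong (W ∷ Ws) f≈g = +-cong (f≈g W) (sumOver-cong Ws f≈g)

  sumOver-+ : ∀ {n} (f g : Subset n → Carrier) Ws → sumOver Ws (λ W → f W + g W) ≈ sumOver Ws f + sumOver Ws g
  sumOver-+ f g []       = sym (+-identityʳ 0#)
  sumOver-+ f g (W ∷ Ws) = trans (+-cong refl (sumOver-+ f g Ws)) (interchange (f W) (g W) _ _)

  sumOver-* : ∀ {n} k (f : Subset n → Carrier) Ws → sumOver Ws (λ W → k * f W) ≈ k * sumOver Ws f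
  sumOver-* k f []       = sym (zeroʳ k)
  sumOver-* k f (W ∷ Ws) = trans (+-cong refl (sumOver-* k f Ws)) (sym (distribˡ k _ _))

  sumOver-0 : ∀ {n} (Ws : List (Subset n)) → sumOver Ws (λ _ → 0#) ≈ 0#
  sumOver-0 []       = refl
  sumOver-0 (W ∷ Ws) = trans (+-identityˡ _) (sumOver-0 Ws)

  sumOver-++ : ∀ {n} (Ws Ws′ : List (Subset n)) f → sumOver (Ws ++ Ws′) f ≈ sumOver Ws f + sumOver Ws′ f
  sumOver-++ Ws Ws′ f = trans (reflexive (foldr-++ (λ W acc → f W + acc) 0# Ws Ws′)) (shift Ws)
    where
    shift : ∀ Vs → foldr (λ W acc → f W + acc) (sumOver Ws′ f) Vs ≈ sumOver Vs f + sumOver Ws′ f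
    shift []       = sym (+-identityˡ _)
    shift (V ∷ Vs) = trans (+-cong refl (shift Vs)) (sym (+-assoc _ _ _))

  Σ-cong : ∀ {n} {f g : Subset n → Carrier} → (∀ W → f W ≈ g W) → Σ f ≈ Σ g
  Σ-cong {n} = sumOver-cong (subsets n)

  Σ-+ : ∀ {n} (f g : Subset n → Carrier) → Σ (λ W → f W + g W) ≈ Σ f + Σ g
  Σ-+ {n} f g = sumOver-+ f g (subsets n)

  Σ-* : ∀ {n} k (f : Subset n → Carrier) → Σ (λ W → k * f W) ≈ k * Σ f
  Σ-* {n} k f = sumOver-* k f (subsets n)

  Σ-neg : ∀ {n} (f : Subset n → Carrier) → Σ (λ W → - f W) ≈ - Σ f
  Σ-neg {n} f = trans (Σ-cong (λ W → sym (-1*x≈-x (f W)))) (trans (Σ-* (- 1#) f) (-1*x≈-x _))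

  Extensional : ∀ {n} → (Subset n → Carrier) → Set c
  Extensional {n} f = ∀ (W W′ : Subset n) → W ≗ W′ → f W ≡ f W′

  cons : ∀ {m} → Bool → Subset m → Subset (suc m)
  cons b W zero    = b
  cons b W (suc i) = W i

  cons-ext : ∀ {m} (f : Subset (suc m) → Carrier) → Extensional f → ∀ b → Extensional (λ W → f (cons b W))
  cons-ext f f-ext b W W′ W≗W′ = f-ext _ _ (λ { zero → ≡.refl ; (suc i) → W≗W′ i })

  Σ-suc : ∀ {m} (f : Subset (suc m) → Carrier) → Extensional f →
          Σ f ≈ Σ (λ W → f (cons false W)) + Σ (λ W → f (cons true W))
  Σ-suc {m} f f-ext =
    trans (sumOver-++ (map _ (subsets m)) (map _ (subsets m)) f)
      (+-cong (trans (reflexive (foldr-map _ _ 0# (subsets m)))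
                     (Σ-cong (λ W → reflexive (f-ext _ (cons false W) (λ { zero → ≡.refl ; (suc i) → ≡.refl })))))
              (trans (reflexive (foldr-map _ _ 0# (subsets m)))
                     (Σ-cong (λ W → reflexive (f-ext _ (cons true W) (λ { zero → ≡.refl ; (suc i) → ≡.refl }))))))

  -- pairSum a f W gathers the terms of W ∖ {a} and W ∪ {a} at the
  -- representative W ∌ a, and vanishes at W ∋ a.
  pairSum : ∀ {n} → Fin n → (Subset n → Carrier) → Subset n → Carrier
  pairSum a f W = if W a then 0# else (f (W [ a ≔ false ]) + f (W [ a ≔ true ]))

  pairSum-ext : ∀ {n} (a : Fin n) f → Extensional f → Extensional (pairSum a f)
  pairSum-ext a f f-ext W W′ W≗W′ =
    ≡.cong₂ (λ s t → if s then 0# else t) (W≗W′ a)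
      (≡.cong₂ _+_ (f-ext _ _ (λ z → ≡.cong (if z == a then false else_) (W≗W′ z)))
                   (f-ext _ _ (λ z → ≡.cong (if z == a then true else_) (W≗W′ z))))

  Σ-pairSum : ∀ {n} (a : Fin n) (f : Subset n → Carrier) → Extensional f → Σ f ≈ Σ (pairSum a f)
  Σ-pairSum {suc m} zero f f-ext = begin
    Σ f                                                               ≈⟨ Σ-suc f f-ext ⟩
    Σ (λ W → f (cons false W)) + Σ (λ W → f (cons true W))            ≈⟨ Σ-+ {m} _ _ ⟨
    Σ (λ W → f (cons false W) + f (cons true W))                      ≈⟨ Σ-cong (λ W → reflexive (pair W)) ⟩
    Σ (λ W → pairSum zero f (cons false W))                           ≈⟨ +-identityʳ _ ⟨
    Σ (λ W → pairSum zero f (cons false W)) + 0#                      ≈⟨ +-cong refl (sumOver-0 (subsets m)) ⟨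
    Σ (λ W → pairSum zero f (cons false W)) + Σ {m} (λ _ → 0#)        ≈⟨ Σ-suc (pairSum zero f) (pairSum-ext zero f f-ext) ⟨
    Σ (pairSum zero f)                                                ∎
    where
    open import Relation.Binary.Reasoning.Setoid setoid
    pair : ∀ W → f (cons false W) + f (cons true W) ≡ pairSum zero f (cons false W)
    pair W = ≡.cong₂ _+_ (f-ext _ _ (λ { zero → ≡.refl ; (suc i) → ≡.refl }))
                         (f-ext _ _ (λ { zero → ≡.refl ; (suc i) → ≡.refl }))
  Σ-pairSum {suc m} (suc a) f f-ext = begin
    Σ f                                                               ≈⟨ Σ-suc f f-ext ⟩
    Σ (λ W → f (cons false W)) + Σ (λ W → f (cons true W))            ≈⟨ +-cong (Σ-pairSum a _ (cons-ext f f-ext false))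
                                                                                (Σ-pairSum a _ (cons-ext f f-ext true)) ⟩
    Σ (pairSum a (λ W → f (cons false W))) + Σ (pairSum a (λ W → f (cons true W)))
                                                                      ≈⟨ +-cong (Σ-cong (λ W → reflexive (commute false W)))
                                                                                (Σ-cong (λ W → reflexive (commute true W))) ⟩
    Σ (λ W → pairSum (suc a) f (cons false W)) + Σ (λ W → pairSum (suc a) f (cons true W))
                                                                      ≈⟨ Σ-suc (pairSum (suc a) f) (pairSum-ext (suc a) f f-ext) ⟨
    Σ (pairSum (suc a) f)                                             ∎
    where
    open import Relation.Binary.Reasoning.Setoid setoid
    commute : ∀ b W → pairSum a (λ W → f (cons b W)) W ≡ pairSum (suc a) f (cons b W)
    commute b W = ≡.cong₂ (λ p q → if W a then 0# else (p + q))
      (f-ext _ _ (λ { zero → ≡.refl ; (suc i) → ≡.sym (≡.cong (if_then false else W i) (suc-== i a)) }))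
      (f-ext _ _ (λ { zero → ≡.refl ; (suc i) → ≡.sym (≡.cong (if_then true else W i) (suc-== i a)) }))

module Neighbourhoods where

  open import Data.Bool using (Bool; true; false; _∧_; _∨_; not)
  import Data.Bool.Properties as BoolP
  open import Relation.Nullary using (¬_)
  open import Relation.Binary.PropositionalEquality
  open FiniteSets

  _⊆V_ : ∀ {n} → Subset n → Graph n → Set
  W ⊆V H = ∀ w → W w ≡ true → V H w ≡ true

  -- "some vertex of W is adjacent to z" (ignoring the vertex set of the graph)
  adjacentTo : ∀ {n} → Graph n → Subset n → Fin n → Bool
  adjacentTo {n} H W z = anyF n (λ w → W w ∧ adj H w z)

  Nbhd-adjoin : ∀ {n} (H : Graph n) (W : Subset n) p q a b → ¬ p ≡ q → W p ≡ false → W q ≡ false → ∀ z →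
    Nbhd H ((W [ p ≔ a ]) [ q ≔ b ]) z
      ≡ V H z ∧ (not (((W [ p ≔ a ]) [ q ≔ b ]) z)
               ∧ ((b ∧ E H q z) ∨ ((a ∧ E H p z) ∨ anyF n (λ w → W w ∧ E H w z))))
  Nbhd-adjoin {n} H W p q a b p≢q Wp Wq z =
    cong (λ t → V H z ∧ (not (((W [ p ≔ a ]) [ q ≔ b ]) z) ∧ t))
      (trans (anyF-update n (W [ p ≔ a ]) q b (λ w → E H w z) (trans (update-≢ W p a q (λ q≡p → p≢q (sym q≡p))) Wq))
             (cong ((b ∧ E H q z) ∨_) (anyF-update n W p a (λ w → E H w z) Wp)))

  anyEdge-inside : ∀ {n} (H : Graph n) (W : Subset n) → W ⊆V H → ∀ z →
    anyF n (λ w → W w ∧ E H w z) ≡ V H z ∧ adjacentTo H W z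
  anyEdge-inside {n} H W W⊆V z = trans (anyF-cong n pointwise) (anyF-∧ˡ n _ (V H z))
    where
    pointwise : ∀ w → W w ∧ E H w z ≡ V H z ∧ (W w ∧ adj H w z)
    pointwise w with W w in Ww
    ... | true  rewrite W⊆V w Ww = refl
    ... | false = sym (BoolP.∧-zeroʳ (V H z))

  -- In the contraction H ∖ a, a set W ⊆ V(H) avoiding a reaches z ∉ W
  -- directly or, when W meets N_H(a), through the new edges among N_H(a).
  anyEdge-contraction : ∀ {n} (H : Graph n) (W : Subset n) a → W ⊆V H → W a ≡ false → ∀ z → W z ≡ false →
    anyF n (λ w → W w ∧ E (H ∖ a) w z)
      ≡ (V H z ∧ not (z == a)) ∧ (adjacentTo H W z ∨ ((V H a ∧ adjacentTo H W a) ∧ E H a z))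
  anyEdge-contraction {n} H W a W⊆V Wa z Wz =
    trans (anyF-cong n pointwise)
    (trans (anyF-∧ˡ n _ K)
    (cong (K ∧_) (trans (anyF-∨ n _ _)
      (cong (adjacentTo H W z ∨_) (trans (anyF-∧ʳ n _ (E H a z)) (cong (_∧ E H a z) (anyF-∧ˡ n _ (V H a))))))))
    where
    K : Bool
    K = V H z ∧ not (z == a)
    pointwise : ∀ w → W w ∧ E (H ∖ a) w z ≡ K ∧ ((W w ∧ adj H w z) ∨ ((V H a ∧ (W w ∧ adj H w a)) ∧ E H a z))
    pointwise w with W w in Ww
    ... | false rewrite BoolP.∧-zeroʳ (V H a) = sym (BoolP.∧-zeroʳ K)
    ... | true rewrite W⊆V w Ww | ≢⇒== (separated {P = W} Ww Wa) | ≢⇒== (separated {P = W} Ww Wz)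
                     | adj-sym H a w = refl

  ⊆V-delete : ∀ {n} (H : Graph n) (D W : Subset n) → W ⊆V H → (∀ w → W w ≡ true → D w ≡ false) → W ⊆V (H ─ D)
  ⊆V-delete H D W W⊆V W∩D w Ww rewrite W⊆V w Ww | W∩D w Ww = refl

  ⊆V-contract : ∀ {n} (H : Graph n) (W : Subset n) a → W ⊆V H → W a ≡ false → W ⊆V (H ∖ a)
  ⊆V-contract H W a W⊆V Wa w Ww rewrite W⊆V w Ww | ≢⇒== (separated {P = W} Ww Wa) = refl

-- For a fixed set W ∌ u, v and a vertex z ∉ W,
-- membership of z in the neighbourhood of W ∪ (a ? {u}) ∪ (b ? {v}) in each
-- graph of the recurrence is a Boolean expression in the local profile
--   Vz = z ∈ V(G), eu = (z = u), ev = (z = v), au = (u ~ z), av = (v ~ z),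
--   nz = (W ~ z), pu = (W ~ u), pv = (W ~ v),
-- and a few constants (Wz = (z ∈ W), V(G) ∋ u, v, u ≠ v, v ~ u, (u = z)).
-- Each law below states that this expression equals the predicted one, and
-- is verified by evaluating it on all profiles.
module VertexLaws where

  open import Data.Bool using (Bool; true; false; _∧_; _∨_; not; if_then_else_)
  open import Data.Vec using (Vec; []; _∷_)
  open import Relation.Binary.PropositionalEquality
  open Tautologies

  -- Constraints on a profile coming from u ~ v, N[v] ⊆ N[u] and u, v ∉ W.
  coherent : (Vz eu ev au av nz pu pv : Bool) → Bool
  coherent Vz eu ev au av nz pu pv =
    (not eu ∨ (Vz ∧ (not ev ∧ (not au ∧ (av ∧ (nz ⇔ pu)))))) ∧
    ((not ev ∨ (Vz ∧ (au ∧ (not av ∧ (nz ⇔ pv))))) ∧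
    ((not (av ∧ Vz) ∨ (eu ∨ au)) ∧ (not pv ∨ pu)))

  Law : Set
  Law = (Wz Vu Vv uv vu avu uz a b Vz eu ev au av nz pu pv : Bool) → Bool

  holds : Law → Law → Bool
  holds L R = valid 10 λ where
    (a ∷ b ∷ Vz ∷ eu ∷ ev ∷ au ∷ av ∷ nz ∷ pu ∷ pv ∷ []) →
      not (coherent Vz eu ev au av nz pu pv) ∨
      (L false true true false false true eu a b Vz eu ev au av nz pu pv
        ⇔ R false true true false false true eu a b Vz eu ev au av nz pu pv)

  holds-sound : ∀ L R → holds L R ≡ true → ∀ a b Vz eu ev au av nz pu pv {Wz Vu Vv uv vu avu uz} →
    Wz ≡ false → Vu ≡ true → Vv ≡ true → uv ≡ false → vu ≡ false → avu ≡ true → uz ≡ eu →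
    coherent Vz eu ev au av nz pu pv ≡ true →
    L Wz Vu Vv uv vu avu uz a b Vz eu ev au av nz pu pv ≡ R Wz Vu Vv uv vu avu uz a b Vz eu ev au av nz pu pv
  holds-sound L R ok a b Vz eu ev au av nz pu pv refl refl refl refl refl refl refl =
    entails 10 (λ where (a ∷ b ∷ Vz ∷ eu ∷ ev ∷ au ∷ av ∷ nz ∷ pu ∷ pv ∷ []) → coherent Vz eu ev au av nz pu pv)
               (λ where (a ∷ b ∷ Vz ∷ eu ∷ ev ∷ au ∷ av ∷ nz ∷ pu ∷ pv ∷ []) →
                          L false true true false false true eu a b Vz eu ev au av nz pu pv)
               (λ where (a ∷ b ∷ Vz ∷ eu ∷ ev ∷ au ∷ av ∷ nz ∷ pu ∷ pv ∷ []) →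
                          R false true true false false true eu a b Vz eu ev au av nz pu pv)
               ok (a ∷ b ∷ Vz ∷ eu ∷ ev ∷ au ∷ av ∷ nz ∷ pu ∷ pv ∷ [])

  -- The shape of Nbhd-adjoin at z: z is a vertex of H, not in W ∪ (a ? {u}) ∪ (b ? {v}),
  -- and adjacent to v (if b), to u (if a), or to W.
  adjoined : (VHz Wz EHv EHu WHz a b eu ev : Bool) → Bool
  adjoined VHz Wz EHv EHu WHz a b eu ev =
    VHz ∧ (not (if ev then b else (if eu then a else Wz)) ∧ ((b ∧ EHv) ∨ ((a ∧ EHu) ∨ WHz)))

  predicted : (Wz X cu cv eu ev : Bool) → Bool
  predicted Wz X cu cv eu ev = if ev then cv else (if eu then cu else (not Wz ∧ ((not eu ∧ not ev) ∧ X)))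

  inG predictG : Law
  inG Wz Vu Vv uv vu avu uz a b Vz eu ev au av nz pu pv =
    adjoined Vz Wz (Vv ∧ (Vz ∧ av)) (Vu ∧ (Vz ∧ au)) (Vz ∧ nz) a b eu ev
  predictG Wz Vu Vv uv vu avu uz a b Vz eu ev au av nz pu pv =
    predicted Wz (if a then (Vz ∧ nz) ∨ (Vz ∧ au) else (if b then (Vz ∧ nz) ∨ (Vz ∧ av) else (Vz ∧ nz)))
                 (not a ∧ (b ∨ pu)) (not b ∧ (a ∨ pv)) eu ev

  lawG : holds inG predictG ≡ true
  lawG = refl

  inG─v predictG─v : Law
  inG─v Wz Vu Vv uv vu avu uz a b Vz eu ev au av nz pu pv =
    adjoined (Vz ∧ not ev) Wz false ((Vu ∧ not uv) ∧ ((Vz ∧ not ev) ∧ au)) ((Vz ∧ not ev) ∧ nz) a false eu ev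
  predictG─v Wz Vu Vv uv vu avu uz a b Vz eu ev au av nz pu pv =
    predicted Wz (if a then (Vz ∧ nz) ∨ (Vz ∧ au) else (Vz ∧ nz)) (not a ∧ pu) false eu ev

  lawG─v : holds inG─v predictG─v ≡ true
  lawG─v = refl

  inG─u predictG─u : Law
  inG─u Wz Vu Vv uv vu avu uz a b Vz eu ev au av nz pu pv =
    adjoined (Vz ∧ not eu) Wz ((Vv ∧ not vu) ∧ ((Vz ∧ not eu) ∧ av)) false ((Vz ∧ not eu) ∧ nz) false b eu ev
  predictG─u Wz Vu Vv uv vu avu uz a b Vz eu ev au av nz pu pv =
    predicted Wz (if b then (Vz ∧ nz) ∨ (Vz ∧ av) else (Vz ∧ nz)) false (not b ∧ pv) eu ev

  lawG─u : holds inG─u predictG─u ≡ true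
  lawG─u = refl

  inG─u─v predictG─u─v : Law
  inG─u─v Wz Vu Vv uv vu avu uz a b Vz eu ev au av nz pu pv =
    adjoined ((Vz ∧ not eu) ∧ not ev) Wz false false (((Vz ∧ not eu) ∧ not ev) ∧ nz) false false eu ev
  predictG─u─v Wz Vu Vv uv vu avu uz a b Vz eu ev au av nz pu pv =
    predicted Wz (Vz ∧ nz) false false eu ev

  lawG─u─v : holds inG─u─v predictG─u─v ≡ true
  lawG─u─v = refl

  inG∖v predictG∖v : Law
  inG∖v Wz Vu Vv uv vu avu uz a b Vz eu ev au av nz pu pv =
    adjoined (Vz ∧ not ev) Wz false
             ((Vu ∧ not uv) ∧ ((Vz ∧ not ev) ∧ (au ∨ (not uz ∧ ((Vv ∧ (Vu ∧ avu)) ∧ (Vv ∧ (Vz ∧ av)))))))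
             ((Vz ∧ not ev) ∧ (nz ∨ ((Vv ∧ pv) ∧ (Vv ∧ (Vz ∧ av))))) a false eu ev
  predictG∖v Wz Vu Vv uv vu avu uz a b Vz eu ev au av nz pu pv =
    predicted Wz (if a then (Vz ∧ nz) ∨ (Vz ∧ au) else (if pv then (Vz ∧ nz) ∨ (Vz ∧ av) else (Vz ∧ nz)))
                 (not a ∧ pu) false eu ev

  lawG∖v : holds inG∖v predictG∖v ≡ true
  lawG∖v = refl

  inG─u∖v predictG─u∖v : Law
  inG─u∖v Wz Vu Vv uv vu avu uz a b Vz eu ev au av nz pu pv =
    adjoined ((Vz ∧ not eu) ∧ not ev) Wz false false
             (((Vz ∧ not eu) ∧ not ev) ∧ (nz ∨ (((Vv ∧ not vu) ∧ pv) ∧ ((Vv ∧ not vu) ∧ ((Vz ∧ not eu) ∧ av)))))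
             false false eu ev
  predictG─u∖v Wz Vu Vv uv vu avu uz a b Vz eu ev au av nz pu pv =
    predicted Wz (if pv then (Vz ∧ nz) ∨ (Vz ∧ av) else (Vz ∧ nz)) false false eu ev

  lawG─u∖v : holds inG─u∖v predictG─u∖v ≡ true
  lawG─u∖v = refl

  inG─v∖u predictG─v∖u : Law
  inG─v∖u Wz Vu Vv uv vu avu uz a b Vz eu ev au av nz pu pv =
    adjoined ((Vz ∧ not ev) ∧ not eu) Wz false false
             (((Vz ∧ not ev) ∧ not eu) ∧ (nz ∨ (((Vu ∧ not uv) ∧ pu) ∧ ((Vu ∧ not uv) ∧ ((Vz ∧ not ev) ∧ au)))))
             false false eu ev
  predictG─v∖u Wz Vu Vv uv vu avu uz a b Vz eu ev au av nz pu pv =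
    predicted Wz (if pu then (Vz ∧ nz) ∨ (Vz ∧ au) else (Vz ∧ nz)) false false eu ev

  lawG─v∖u : holds inG─v∖u predictG─v∖u ≡ true
  lawG─v∖u = refl

  inG─N[u] predictG─N[u] : Law
  inG─N[u] Wz Vu Vv uv vu avu uz a b Vz eu ev au av nz pu pv =
    adjoined (Vz ∧ not ((Vz ∧ eu) ∨ (Vu ∧ (Vz ∧ au)))) Wz false false
             ((Vz ∧ not ((Vz ∧ eu) ∨ (Vu ∧ (Vz ∧ au)))) ∧ nz) false false eu ev
  predictG─N[u] Wz Vu Vv uv vu avu uz a b Vz eu ev au av nz pu pv =
    predicted Wz ((Vz ∧ nz) ∧ not au) false false eu ev

  lawG─N[u] : holds inG─N[u] predictG─N[u] ≡ true
  lawG─N[u] = refl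

  -- When no vertex of W is adjacent to u, the part of N(W) ∪ N(u) outside
  -- W ∪ {u, v} (g = "z ∉ {u, v}") is the disjoint union of the part of
  -- N(W) ∖ N(u) and of N(u) ∖ {u, v}.
  split-law : ∀ Wz g Vz nz au → (Wz ∧ au) ≡ false →
    not Wz ∧ (g ∧ ((Vz ∧ nz) ∨ (Vz ∧ au))) ≡ (not Wz ∧ (g ∧ ((Vz ∧ nz) ∧ not au))) ∨ (g ∧ (Vz ∧ au))
  split-law Wz g Vz nz au h =
    entails 5 (λ where (Wz ∷ g ∷ Vz ∷ nz ∷ au ∷ []) → not (Wz ∧ au))
              (λ where (Wz ∷ g ∷ Vz ∷ nz ∷ au ∷ []) → not Wz ∧ (g ∧ ((Vz ∧ nz) ∨ (Vz ∧ au))))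
              (λ where (Wz ∷ g ∷ Vz ∷ nz ∷ au ∷ []) → (not Wz ∧ (g ∧ ((Vz ∧ nz) ∧ not au))) ∨ (g ∧ (Vz ∧ au)))
              refl (Wz ∷ g ∷ Vz ∷ nz ∷ au ∷ []) (cong not h)

  split-disjoint : ∀ Wz g Vz nz au → (not Wz ∧ (g ∧ ((Vz ∧ nz) ∧ not au))) ∧ (g ∧ (Vz ∧ au)) ≡ false
  split-disjoint Wz g Vz nz au =
    entails 5 (λ _ → true)
              (λ where (Wz ∷ g ∷ Vz ∷ nz ∷ au ∷ []) → (not Wz ∧ (g ∧ ((Vz ∧ nz) ∧ not au))) ∧ (g ∧ (Vz ∧ au)))
              (λ _ → false)
              refl (Wz ∷ g ∷ Vz ∷ nz ∷ au ∷ []) refl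

-- Expressions over arbitrary operations _⊕_, _⊗_ and constant o, so that the
-- same expression can be read in a ring and as input to the semiring solver.
module Shapes {a} {A : Set a} (_⊕_ _⊗_ : A → A → A) (o : A) where

  open import Data.Product using (_×_; _,_)

  quad : A → A → A → A → A
  quad t₀₀ t₀₁ t₁₀ t₁₁ = (t₀₀ ⊕ t₀₁) ⊕ (t₁₀ ⊕ t₁₁)

  -- The recurrence with 1 − y multiplied out, as positive part minus negative
  -- part; Q stands for q·TN.
  positive negative : (x y tv tuv tu tcv tucv tvcu Q : A) → A
  positive x y tv tuv tu tcv tucv tvcu Q =
    ((((x ⊕ y) ⊗ tv) ⊕ (y ⊗ tu)) ⊕ (tcv ⊕ (y ⊗ ((y ⊗ tucv) ⊕ (x ⊗ tvcu))))) ⊕ (y ⊗ (x ⊗ Q))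
  negative x y tv tuv tu tcv tucv tvcu Q =
    (((y ⊗ (x ⊕ y)) ⊗ tuv) ⊕ (((y ⊗ tucv) ⊕ (x ⊗ tvcu)) ⊕ (y ⊗ tcv))) ⊕ (x ⊗ Q)

  balance : (x y tG tv tuv tu tcv tucv tvcu Q : A) → A × A
  balance x y tG tv tuv tu tcv tucv tvcu Q =
    tG ⊕ negative x y tv tuv tu tcv tucv tvcu Q , positive x y tv tuv tu tcv tucv tvcu Q

  -- The fibre values when W is adjacent to both u and v; X = x^|W|, and
  -- Ym, YA, YB are y to the size of the part of N(W), N(W) ∪ N(u), N(W) ∪ N(v)
  -- outside W ∪ {u, v}.
  bothAdjacent : (x y q X Ym YA YB : A) → A × A
  bothAdjacent x y q X Ym YA YB = balance x y
    (quad (X ⊗ (y ⊗ (y ⊗ Ym))) ((x ⊗ X) ⊗ (y ⊗ YB)) ((x ⊗ X) ⊗ (y ⊗ YA)) ((x ⊗ (x ⊗ X)) ⊗ YA))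
    (quad (X ⊗ (y ⊗ Ym)) o ((x ⊗ X) ⊗ YA) o) (quad (X ⊗ Ym) o o o) (quad (X ⊗ (y ⊗ Ym)) ((x ⊗ X) ⊗ YB) o o)
    (quad (X ⊗ (y ⊗ YB)) o ((x ⊗ X) ⊗ YA) o) (quad (X ⊗ YB) o o o) (quad (X ⊗ YA) o o o) (q ⊗ quad o o o o)

  onlyU : (x y q X Ym YA YB : A) → A × A
  onlyU x y q X Ym YA YB = balance x y
    (quad (X ⊗ (y ⊗ Ym)) ((x ⊗ X) ⊗ (y ⊗ YB)) ((x ⊗ X) ⊗ (y ⊗ YA)) ((x ⊗ (x ⊗ X)) ⊗ YA))
    (quad (X ⊗ (y ⊗ Ym)) o ((x ⊗ X) ⊗ YA) o) (quad (X ⊗ Ym) o o o) (quad (X ⊗ Ym) ((x ⊗ X) ⊗ YB) o o)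
    (quad (X ⊗ (y ⊗ Ym)) o ((x ⊗ X) ⊗ YA) o) (quad (X ⊗ Ym) o o o) (quad (X ⊗ YA) o o o) (q ⊗ quad o o o o)

  -- W adjacent to neither; here q·TN = X·YA.
  neither : (x y X Ym YA YB : A) → A × A
  neither x y X Ym YA YB = balance x y
    (quad (X ⊗ Ym) ((x ⊗ X) ⊗ (y ⊗ YB)) ((x ⊗ X) ⊗ (y ⊗ YA)) ((x ⊗ (x ⊗ X)) ⊗ YA))
    (quad (X ⊗ Ym) o ((x ⊗ X) ⊗ YA) o) (quad (X ⊗ Ym) o o o) (quad (X ⊗ Ym) ((x ⊗ X) ⊗ YB) o o)
    (quad (X ⊗ Ym) o ((x ⊗ X) ⊗ YA) o) (quad (X ⊗ Ym) o o o) (quad (X ⊗ Ym) o o o) (X ⊗ YA)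

module RecurrenceAlgebra {c ℓ : Level} (R : CommutativeRing c ℓ) (x y : CommutativeRing.Carrier R) (d : ℕ) where

  open CommutativeRing R
  open import Algebra.Properties.Ring ring using (-‿distribˡ-*; x[y-z]≈xy-xz)
  open import Algebra.Properties.AbelianGroup +-abelianGroup using (⁻¹-∙-comm; ⁻¹-anti-homo‿-)
  open import Algebra.Properties.CommutativeSemigroup +-commutativeSemigroup using (interchange; xy∙z≈xz∙y)
  open import Algebra.Properties.CommutativeSemigroup *-commutativeSemigroup using (x∙yz≈y∙xz)
  open import Algebra.Solver.Ring.NaturalCoefficients.Default commutativeSemiring using (solve; Polynomial; _:+_; _:*_; _:=_; con)
  open import Relation.Binary.Reasoning.Setoid setoid
  open import Data.Product using (_×_; _,_)
  import Data.Nat as ℕ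
  open import Data.Bool using (Bool; true; false; if_then_else_)
  import Relation.Binary.PropositionalEquality as ≡
  open FiniteSets using (bit)

  module Value = Shapes _+_ _*_ 0#
  module Syntax = Shapes {A = Polynomial 7} _:+_ _:*_ (con 0)

  -- The factor y^(deg(u) − 1) of the last term.
  q : Carrier
  q = pow R y d

  combo : (tv tuv tu tcv tucv tvcu tN : Carrier) → Carrier
  combo tv tuv tu tcv tucv tvcu tN =
    ((((x + y) * tv + - (y * (x + y) * tuv)) + y * tu)
      + (1# + - y) * ((tcv + - (y * tucv)) + - (x * tvcu)))
      + - (x * (1# + - y) * q * tN)

  combo-cong : ∀ {tv tuv tu tcv tucv tvcu tN tv′ tuv′ tu′ tcv′ tucv′ tvcu′ tN′} →
    tv ≈ tv′ → tuv ≈ tuv′ → tu ≈ tu′ → tcv ≈ tcv′ → tucv ≈ tucv′ → tvcu ≈ tvcu′ → tN ≈ tN′ →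
    combo tv tuv tu tcv tucv tvcu tN ≈ combo tv′ tuv′ tu′ tcv′ tucv′ tvcu′ tN′
  combo-cong e₁ e₂ e₃ e₄ e₅ e₆ e₇ =
    +-cong (+-cong (+-cong (+-cong (*-cong refl e₁) (-‿cong (*-cong refl e₂))) (*-cong refl e₃))
                   (*-cong refl (+-cong (+-cong e₄ (-‿cong (*-cong refl e₅))) (-‿cong (*-cong refl e₆)))))
           (-‿cong (*-cong refl e₇))

  combo-zero : combo 0# 0# 0# 0# 0# 0# 0# ≈ 0#
  combo-zero = begin
    combo 0# 0# 0# 0# 0# 0# 0#                                        ≈⟨ +-cong (+-cong (+-cong (+-cong (zeroʳ _) (-‿cong (zeroʳ _))) (zeroʳ _))
                                                                           (*-cong refl (+-cong (+-cong refl (-‿cong (zeroʳ _))) (-‿cong (zeroʳ _)))))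
                                                                           (-‿cong (zeroʳ _)) ⟩
    (((0# + - 0#) + 0#) + (1# + - y) * ((0# + - 0#) + - 0#)) + - 0#   ≈⟨ +-cong (+-cong (+-cong (-‿inverseʳ 0#) refl)
                                                                           (*-cong refl (+-cong (-‿inverseʳ 0#) refl))) refl ⟩
    ((0# + 0#) + (1# + - y) * (0# + - 0#)) + - 0#                      ≈⟨ +-cong (+-cong (+-identityʳ 0#) (*-cong refl (-‿inverseʳ 0#))) refl ⟩
    (0# + (1# + - y) * 0#) + - 0#                                      ≈⟨ +-cong (+-cong refl (zeroʳ _)) refl ⟩
    (0# + 0#) + - 0#                                                   ≈⟨ +-cong (+-identityʳ 0#) refl ⟩
    0# + - 0#                                                          ≈⟨ -‿inverseʳ 0# ⟩
    0#                                                                 ∎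

  diff-+ : ∀ a b c d → (a + - b) + (c + - d) ≈ (a + c) + - (b + d)
  diff-+ a b c d = trans (interchange a (- b) c (- d)) (+-cong refl (⁻¹-∙-comm b d))

  diff-+ʳ : ∀ a b c → (a + - b) + c ≈ (a + c) + - b
  diff-+ʳ a b c = xy∙z≈xz∙y a (- b) c

  diff-intro : ∀ {a b d} → d + b ≈ a → d ≈ a + - b
  diff-intro {a} {b} {d} d+b≈a = begin
    d                ≈⟨ +-identityʳ d ⟨
    d + 0#           ≈⟨ +-cong refl (-‿inverseʳ b) ⟨
    d + (b + - b)    ≈⟨ +-assoc d b (- b) ⟨
    (d + b) + - b    ≈⟨ +-cong d+b≈a refl ⟩
    a + - b          ∎

  one-minus : ∀ t → (1# + - y) * t ≈ t + - (y * t)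
  one-minus t = begin
    (1# + - y) * t       ≈⟨ distribʳ t 1# (- y) ⟩
    1# * t + - y * t     ≈⟨ +-cong (*-identityˡ t) (sym (-‿distribˡ-* y t)) ⟩
    t + - (y * t)        ∎

  positive negative : (tv tuv tu tcv tucv tvcu Q : Carrier) → Carrier
  positive = Value.positive x y
  negative = Value.negative x y

  combo-as-difference : ∀ tv tuv tu tcv tucv tvcu tN →
    combo tv tuv tu tcv tucv tvcu tN ≈ positive tv tuv tu tcv tucv tvcu (q * tN) + - negative tv tuv tu tcv tucv tvcu (q * tN)
  combo-as-difference tv tuv tu tcv tucv tvcu tN = begin
    combo tv tuv tu tcv tucv tvcu tN
      ≈⟨ +-cong (+-cong (diff-+ʳ _ _ _) contracted) deleted ⟩
    ((((x + y) * tv + y * tu) + - N₁) + ((tcv + y * B) + - (B + y * tcv))) + (y * T + - T)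
      ≈⟨ +-cong (diff-+ _ _ _ _) refl ⟩
    ((((x + y) * tv + y * tu) + (tcv + y * B)) + - (N₁ + (B + y * tcv))) + (y * T + - T)
      ≈⟨ diff-+ _ _ _ _ ⟩
    positive tv tuv tu tcv tucv tvcu (q * tN) + - negative tv tuv tu tcv tucv tvcu (q * tN) ∎
    where
    N₁ B T : Carrier
    N₁ = y * (x + y) * tuv
    B  = y * tucv + x * tvcu
    T  = x * (q * tN)
    contracted : (1# + - y) * ((tcv + - (y * tucv)) + - (x * tvcu)) ≈ (tcv + y * B) + - (B + y * tcv)
    contracted = begin
      (1# + - y) * ((tcv + - (y * tucv)) + - (x * tvcu)) ≈⟨ *-cong refl (trans (+-assoc _ _ _) (+-cong refl (⁻¹-∙-comm _ _))) ⟩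
      (1# + - y) * (tcv + - B)                           ≈⟨ one-minus _ ⟩
      (tcv + - B) + - (y * (tcv + - B))                  ≈⟨ +-cong refl (-‿cong (x[y-z]≈xy-xz y tcv B)) ⟩
      (tcv + - B) + - (y * tcv + - (y * B))              ≈⟨ +-cong refl (⁻¹-anti-homo‿- (y * tcv) (y * B)) ⟩
      (tcv + - B) + (y * B + - (y * tcv))                ≈⟨ diff-+ _ _ _ _ ⟩
      (tcv + y * B) + - (B + y * tcv)                    ∎
    deleted : - (x * (1# + - y) * q * tN) ≈ y * T + - T
    deleted = begin
      - (x * (1# + - y) * q * tN)   ≈⟨ -‿cong (solve 4 (λ x w q t → ((x :* w) :* q) :* t := w :* (x :* (q :* t))) refl x (1# + - y) q tN) ⟩
      - ((1# + - y) * T)            ≈⟨ -‿cong (one-minus T) ⟩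
      - (T + - (y * T))             ≈⟨ ⁻¹-anti-homo‿- T (y * T) ⟩
      y * T + - T                   ∎

  Holds : Carrier × Carrier → Set ℓ
  Holds (lhs , rhs) = lhs ≈ rhs

  bothAdjacent-holds : ∀ X Ym YA YB → Holds (Value.bothAdjacent x y q X Ym YA YB)
  bothAdjacent-holds = solve 7 (λ x y q X Ym YA YB → Syntax.bothAdjacent x y q X Ym YA YB) refl x y q

  onlyU-holds : ∀ X Ym YA YB → Holds (Value.onlyU x y q X Ym YA YB)
  onlyU-holds = solve 7 (λ x y q X Ym YA YB → Syntax.onlyU x y q X Ym YA YB) refl x y q

  neither-holds : ∀ X Ym YA YB → Holds (Value.neither x y X Ym YA YB)
  neither-holds = solve 7 (λ x y q X Ym YA YB → Syntax.neither x y X Ym YA YB) refl x y q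

  pow-+ : ∀ a b → pow R y (a ℕ.+ b) ≈ pow R y a * pow R y b
  pow-+ ℕ.zero    b = sym (*-identityˡ _)
  pow-+ (ℕ.suc a) b = trans (*-cong refl (pow-+ a b)) (sym (*-assoc _ _ _))

  -- The recurrence on one fibre {W, W+u, W+v, W+u+v}, W ⊆ V(G) ∖ {u, v}, in
  -- terms of k = |W|, of pu, pv (W adjacent to u, v) and of the sizes m, ma, mb,
  -- mn of the parts of N(W), N(W) ∪ N(u), N(W) ∪ N(v), N(W) ∖ N(u) outside
  -- W ∪ {u, v}.  The arguments of combo are the fibre sums of G − v,
  -- G − u − v, G − u, G ∖ v, (G − u) ∖ v, (G − v) ∖ u, G − N[u].
  fibre-identity : ∀ (pu pv : Bool) → (pv ≡.≡ true → pu ≡.≡ true) → ∀ k m ma mb mn → (pu ≡.≡ false → ma ≡.≡ d ℕ.+ mn) →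
    let X = pow R x k ; Y = pow R y in
    (X * Y (bit pv ℕ.+ (bit pu ℕ.+ m)) + pow R x (ℕ.suc k) * Y (ℕ.suc mb))
      + (pow R x (ℕ.suc k) * Y (ℕ.suc ma) + pow R x (ℕ.suc (ℕ.suc k)) * Y ma)
    ≈ combo ((X * Y (bit pu ℕ.+ m) + 0#) + (pow R x (ℕ.suc k) * Y ma + 0#))
            ((X * Y m + 0#) + (0# + 0#))
            ((X * Y (bit pv ℕ.+ m) + pow R x (ℕ.suc k) * Y mb) + (0# + 0#))
            ((X * Y (bit pu ℕ.+ (if pv then mb else m)) + 0#) + (pow R x (ℕ.suc k) * Y ma + 0#))
            ((X * Y (if pv then mb else m) + 0#) + (0# + 0#))
            ((X * Y (if pu then ma else m) + 0#) + (0# + 0#))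
            (((if pu then 0# else X * Y mn) + 0#) + (0# + 0#))
  fibre-identity true true _ k m ma mb mn _ =
    trans (diff-intro (bothAdjacent-holds (pow R x k) (pow R y m) (pow R y ma) (pow R y mb)))
          (sym (combo-as-difference _ _ _ _ _ _ _))
  fibre-identity true false _ k m ma mb mn _ =
    trans (diff-intro (onlyU-holds (pow R x k) (pow R y m) (pow R y ma) (pow R y mb)))
          (sym (combo-as-difference _ _ _ _ _ _ _))
  fibre-identity false true pv⇒pu with pv⇒pu ≡.refl
  ... | ()
  fibre-identity false false _ k m ma mb mn ma≡d+mn with ma≡d+mn ≡.refl
  ... | ≡.refl =
    -- replace q·TN by X·YA in the negative and the positive part
    trans (diff-intro (trans (+-cong refl (+-cong refl (*-cong refl qTN≈XYA)))
                      (trans (neither-holds X (pow R y m) (pow R y ma) (pow R y mb))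
                             (+-cong refl (*-cong refl (*-cong refl (sym qTN≈XYA)))))))
          (sym (combo-as-difference _ _ _ _ _ _ _))
    where
    X : Carrier
    X = pow R x k
    -- the G − N[u] term, multiplied by q, is the term of W + u in G − v
    qTN≈XYA : q * ((X * pow R y mn + 0#) + (0# + 0#)) ≈ X * pow R y ma
    qTN≈XYA = begin
      q * ((X * pow R y mn + 0#) + (0# + 0#))   ≈⟨ *-cong refl (trans (+-cong (+-identityʳ _) (+-identityʳ 0#)) (+-identityʳ _)) ⟩
      q * (X * pow R y mn)                      ≈⟨ x∙yz≈y∙xz q X (pow R y mn) ⟩
      X * (q * pow R y mn)                      ≈⟨ *-cong refl (pow-+ d mn) ⟨
      X * pow R y ma                            ∎

module DominatedPair {n : ℕ} (G : Graph n) (u v : Fin n) (Vu : V G u ≡ true) (Vv : V G v ≡ true) (Euv : E G u v ≡ true)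
  (dom : ∀ z → V G z ≡ true → (z ≡ v ⊎ E G v z ≡ true) → (z ≡ u ⊎ E G u z ≡ true)) where

  open import Data.Nat using (suc; _+_)
  open import Data.Nat.Properties using (+-comm)
  open import Data.Bool using (Bool; false; _∧_; _∨_; not; if_then_else_)
  import Data.Bool.Properties as BoolP
  open import Data.Product using (∃; _×_; _,_)
  open import Data.Sum using (inj₁; inj₂)
  open import Data.Empty using (⊥-elim)
  open import Relation.Nullary using (¬_)
  open import Relation.Binary.PropositionalEquality
  open FiniteSets
  open Tautologies using (_⇔_)
  open Neighbourhoods
  open VertexLaws

  u~v : adj G u v ≡ true
  u~v = subst₂ (λ s t → s ∧ (t ∧ adj G u v) ≡ true) Vu Vv Euv

  v~u : adj G v u ≡ true
  v~u = trans (adj-sym G v u) u~v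

  u≢v : ¬ u ≡ v
  u≢v refl with trans (sym u~v) (adj-irrefl G u)
  ... | ()

  u≠v : (u == v) ≡ false
  u≠v = ≢⇒== u≢v

  v≠u : (v == u) ≡ false
  v≠u = ≢⇒== (λ v≡u → u≢v (sym v≡u))

  G─v G─u G─u─v G∖v G─u∖v G─v∖u G─N[u] : Graph n
  G─v    = G ─ ⟦ v ⟧
  G─u    = G ─ ⟦ u ⟧
  G─u─v  = (G ─ ⟦ u ⟧) ─ ⟦ v ⟧
  G∖v    = G ∖ v
  G─u∖v  = (G ─ ⟦ u ⟧) ∖ v
  G─v∖u  = (G ─ ⟦ v ⟧) ∖ u
  G─N[u] = G ─ (N[ u ] G)

  absent : ∀ {b} c → b ≡ true → c ∧ not b ≡ false
  absent c refl = BoolP.∧-zeroʳ c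

  v∉G─v : V G─v v ≡ false
  v∉G─v = absent (V G v) (==-refl v)
  u∉G─u : V G─u u ≡ false
  u∉G─u = absent (V G u) (==-refl u)
  u∉G─u─v : V G─u─v u ≡ false
  u∉G─u─v = cong (_∧ not (u == v)) u∉G─u
  v∉G─u─v : V G─u─v v ≡ false
  v∉G─u─v = absent (V G─u v) (==-refl v)
  v∉G∖v : V G∖v v ≡ false
  v∉G∖v = absent (V G v) (==-refl v)
  u∉G─u∖v : V G─u∖v u ≡ false
  u∉G─u∖v = cong (_∧ not (u == v)) u∉G─u
  v∉G─u∖v : V G─u∖v v ≡ false
  v∉G─u∖v = absent (V G─u v) (==-refl v)
  u∉G─v∖u : V G─v∖u u ≡ false
  u∉G─v∖u = absent (V G─v u) (==-refl u)
  v∉G─v∖u : V G─v∖u v ≡ false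
  v∉G─v∖u = cong (_∧ not (v == u)) v∉G─v
  u∉G─N[u] : V G─N[u] u ≡ false
  u∉G─N[u] = absent (V G u) (trans (cong (λ t → (t ∧ (u == u)) ∨ E G u u) Vu) (cong (_∨ E G u u) (==-refl u)))
  v∉G─N[u] : V G─N[u] v ≡ false
  v∉G─N[u] = absent (V G v) (trans (cong ((V G v ∧ (v == u)) ∨_) Euv) (BoolP.∨-zeroʳ _))

  u∈G─v : V G─v u ≡ true
  u∈G─v = cong₂ (λ s t → s ∧ not t) Vu u≠v
  v∈G─u : V G─u v ≡ true
  v∈G─u = cong₂ (λ s t → s ∧ not t) Vv v≠u

  degree : deg G u ≡ suc (count n (λ z → (not (z == u) ∧ not (z == v)) ∧ (V G z ∧ adj G u z)))
  degree = trans (count-cong n pointwise) (count-update n _ v true v-excluded)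
    where
    shape : ∀ eu ev Vz au → (ev ≡ true → (Vz ∧ au) ≡ true) → (eu ≡ true → au ≡ false) →
            (Vz ∧ au) ≡ (if ev then true else ((not eu ∧ not ev) ∧ (Vz ∧ au)))
    shape eu    true  Vz au at-v at-u = at-v refl
    shape true  false Vz au at-v at-u rewrite at-u refl = BoolP.∧-zeroʳ Vz
    shape false false Vz au at-v at-u = refl
    v-excluded : (not (v == u) ∧ not (v == v)) ∧ (V G v ∧ adj G u v) ≡ false
    v-excluded rewrite ==-refl v = cong (_∧ (V G v ∧ adj G u v)) (BoolP.∧-zeroʳ (not (v == u)))
    pointwise : ∀ z → E G u z ≡ ((λ z → (not (z == u) ∧ not (z == v)) ∧ (V G z ∧ adj G u z)) [ v ≔ true ]) z
    pointwise z = trans (cong (_∧ (V G z ∧ adj G u z)) Vu)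
      (shape (z == u) (z == v) (V G z) (adj G u z)
        (λ z=v → subst (λ t → (V G t ∧ adj G u t) ≡ true) (sym (==⇒≡ z=v)) (cong₂ _∧_ Vv u~v))
        (λ z=u → subst (λ t → adj G u t ≡ false) (sym (==⇒≡ z=u)) (adj-irrefl G u)))

  implies : ∀ {a b} → (a ≡ true → b ≡ true) → not a ∨ b ≡ true
  implies {true}  h = h refl
  implies {false} h = refl

  both : ∀ {a b} → a ≡ true → b ≡ true → a ∧ b ≡ true
  both refl refl = refl

  ⇔-refl : ∀ b → (b ⇔ b) ≡ true
  ⇔-refl true  = refl
  ⇔-refl false = refl

  dominated : ∀ z → (adj G v z ∧ V G z) ≡ true → ((z == u) ∨ adj G u z) ≡ true
  dominated z h with adj G v z in v~z | V G z in Vz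
  dominated z refl | true | true with dom z Vz (inj₂ (subst₂ (λ s t → s ∧ (t ∧ adj G v z) ≡ true) (sym Vv) (sym Vz) v~z))
  ... | inj₁ refl = cong (_∨ adj G u u) (==-refl u)
  ... | inj₂ u~z rewrite subst₂ (λ s t → s ∧ (t ∧ adj G u z) ≡ true) Vu Vz u~z = BoolP.∨-zeroʳ (z == u)

  module Fibre (W : Subset n) (Wu : W u ≡ false) (Wv : W v ≡ false) (W⊆G : W ⊆V G) where

    member : Bool → Bool → Subset n
    member a b = (W [ u ≔ a ]) [ v ≔ b ]

    pu pv : Bool
    pu = adjacentTo G W u
    pv = adjacentTo G W v

    M A B : Subset n
    M z = V G z ∧ adjacentTo G W z
    A z = V G z ∧ adj G u z
    B z = V G z ∧ adj G v z

    off-uv : Subset n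
    off-uv z = not (z == u) ∧ not (z == v)

    outside : Subset n → Subset n
    outside X z = not (W z) ∧ (off-uv z ∧ X z)

    predictedNbhd : Subset n → Bool → Bool → Subset n
    predictedNbhd X cu cv = (outside X [ u ≔ cu ]) [ v ≔ cv ]

    count-member : ∀ a b → count n (member a b) ≡ bit b + (bit a + count n W)
    count-member a b = trans (count-update n (W [ u ≔ a ]) v b (trans (update-≢ W u a v (λ v≡u → u≢v (sym v≡u))) Wv))
                             (cong (bit b +_) (count-update n W u a Wu))

    count-predicted : ∀ X cu cv → count n (predictedNbhd X cu cv) ≡ bit cv + (bit cu + count n (outside X))
    count-predicted X cu cv =
      trans (count-update n (outside X [ u ≔ cu ]) v cv (trans (update-≢ (outside X) u cu v (λ v≡u → u≢v (sym v≡u))) at-v))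
            (cong (bit cv +_) (count-update n (outside X) u cu at-u))
      where
      at-u : outside X u ≡ false
      at-u rewrite Wu | ==-refl u = refl
      at-v : outside X v ≡ false
      at-v rewrite Wv | v≠u | ==-refl v = refl

    count-outside-if : ∀ c (P Q : Subset n) →
      count n (outside (λ z → if c then P z else Q z)) ≡ (if c then count n (outside P) else count n (outside Q))
    count-outside-if true  P Q = refl
    count-outside-if false P Q = refl

    pv⇒pu : pv ≡ true → pu ≡ true
    pv⇒pu h with anyF-witness n (λ w → W w ∧ adj G w v) h
    ... | w , w~v with W w in Ww
    ...   | true with dom w (W⊆G w Ww) (inj₂ (subst₂ (λ s t → s ∧ (t ∧ adj G v w) ≡ true) (sym Vv) (sym (W⊆G w Ww))
                                                 (trans (adj-sym G v w) w~v)))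
    ...     | inj₁ refl = ⊥-elim (separated {P = W} Ww Wu refl)
    ...     | inj₂ u~w = anyF-intro n (λ w → W w ∧ adj G w u) w
                 (subst (λ t → t ∧ adj G w u ≡ true) (sym Ww)
                        (trans (adj-sym G w u) (subst₂ (λ s t → s ∧ (t ∧ adj G u w) ≡ true) Vu (W⊆G w Ww) u~w)))

    coherence : ∀ z → coherent (V G z) (z == u) (z == v) (adj G u z) (adj G v z) (adjacentTo G W z) pu pv ≡ true
    coherence z = both (implies at-u) (both (implies at-v) (both (implies (dominated z)) (implies pv⇒pu)))
      where
      at-u : (z == u) ≡ true → V G z ∧ (not (z == v) ∧ (not (adj G u z) ∧ (adj G v z ∧ (adjacentTo G W z ⇔ pu)))) ≡ true
      at-u z=u with ==⇒≡ z=u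
      ... | refl = both Vu (both (cong not u≠v) (both (cong not (adj-irrefl G u)) (both v~u (⇔-refl pu))))
      at-v : (z == v) ≡ true → V G z ∧ (adj G u z ∧ (not (adj G v z) ∧ (adjacentTo G W z ⇔ pv))) ≡ true
      at-v z=v with ==⇒≡ z=v
      ... | refl = both Vv (both u~v (both (cong not (adj-irrefl G v)) (⇔-refl pv)))

    Local : Law → Bool → Bool → Fin n → Bool
    Local L a b z = L (W z) (V G u) (V G v) (u == v) (v == u) (adj G v u) (u == z)
                      a b (V G z) (z == u) (z == v) (adj G u z) (adj G v z) (adjacentTo G W z) pu pv

    atVertex : ∀ L R → holds L R ≡ true → ∀ a b z → W z ≡ false → Local L a b z ≡ Local R a b z
    atVertex L R ok a b z Wz = holds-sound L R ok a b _ _ _ _ _ _ _ _ Wz Vu Vv u≠v v≠u v~u (==-sym u z) (coherence z)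

    member-W : ∀ a b z → W z ≡ true → member a b z ≡ true
    member-W a b z Wz = trans (update-≢ (W [ u ≔ a ]) v b z (separated {P = W} Wz Wv))
                              (trans (update-≢ W u a z (separated {P = W} Wz Wu)) Wz)

    nbhd-on-W : ∀ H a b X cu cv z → W z ≡ true → Nbhd H (member a b) z ≡ predictedNbhd X cu cv z
    nbhd-on-W H a b X cu cv z Wz =
      trans (trans (cong (λ t → V H z ∧ (not t ∧ anyF n (λ w → member a b w ∧ E H w z))) (member-W a b z Wz)) (BoolP.∧-zeroʳ (V H z)))
            (sym (trans (update-≢ (outside X [ u ≔ cu ]) v cv z (separated {P = W} Wz Wv))
                 (trans (update-≢ (outside X) u cu z (separated {P = W} Wz Wu)) (cong (λ s → not s ∧ _) Wz))))

    nbhd-via : ∀ H a b z {t} → anyF n (λ w → W w ∧ E H w z) ≡ t →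
      Nbhd H (member a b) z ≡ adjoined (V H z) (W z) (E H v z) (E H u z) t a b (z == u) (z == v)
    nbhd-via H a b z e =
      trans (Nbhd-adjoin H W u v a b u≢v Wu Wv z) (cong (λ t → V H z ∧ (not (member a b z) ∧ ((b ∧ E H v z) ∨ ((a ∧ E H u z) ∨ t)))) e)

    byMembership : ∀ {ℓ} {P : Set ℓ} z → (W z ≡ true → P) → (W z ≡ false → P) → P
    byMembership {P = P} z = decide (W z)
      where
      decide : ∀ b → (b ≡ true → P) → (b ≡ false → P) → P
      decide true  on off = on refl
      decide false on off = off refl

    member-⊆ : ∀ H a b → (a ≡ true → V H u ≡ true) → (b ≡ true → V H v ≡ true) → W ⊆V H → member a b ⊆V H
    member-⊆ H a b u∈ v∈ W⊆H w h with w == v in w=v | w == u in w=u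
    ... | true | _     rewrite ==⇒≡ w=v = v∈ h
    ... | false | true rewrite ==⇒≡ w=u = u∈ h
    ... | false | false = W⊆H w h

    u∈member : ∀ b → member true b u ≡ true
    u∈member b = trans (update-≢ (W [ u ≔ true ]) v b u u≢v) (update-≡ W u true)

    v∈member : ∀ a → member a true v ≡ true
    v∈member a = update-≡ (W [ u ≔ a ]) v true

    avoids : ∀ p → W p ≡ false → ∀ w → W w ≡ true → ⟦ p ⟧ w ≡ false
    avoids p Wp w Ww = ≢⇒== (separated {P = W} Ww Wp)

    W⊆G─v : W ⊆V G─v
    W⊆G─v = ⊆V-delete G ⟦ v ⟧ W W⊆G (avoids v Wv)
    W⊆G─u : W ⊆V G─u
    W⊆G─u = ⊆V-delete G ⟦ u ⟧ W W⊆G (avoids u Wu)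
    W⊆G─u─v : W ⊆V G─u─v
    W⊆G─u─v = ⊆V-delete G─u ⟦ v ⟧ W W⊆G─u (avoids v Wv)
    W⊆G∖v : W ⊆V G∖v
    W⊆G∖v = ⊆V-contract G W v W⊆G Wv
    W⊆G─u∖v : W ⊆V G─u∖v
    W⊆G─u∖v = ⊆V-contract G─u W v W⊆G─u Wv
    W⊆G─v∖u : W ⊆V G─v∖u
    W⊆G─v∖u = ⊆V-contract G─v W u W⊆G─v Wu

    XG : Bool → Bool → Subset n
    XG a b z = if a then M z ∨ A z else (if b then M z ∨ B z else M z)

    nbhd-G : ∀ a b z → Nbhd G (member a b) z ≡ predictedNbhd (XG a b) (not a ∧ (b ∨ pu)) (not b ∧ (a ∨ pv)) z
    nbhd-G a b z = byMembership z (nbhd-on-W G a b (XG a b) _ _ z) λ Wz →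
      trans (nbhd-via G a b z (anyEdge-inside G W W⊆G z)) (atVertex inG predictG lawG a b z Wz)

    XG─v : Bool → Subset n
    XG─v a z = if a then M z ∨ A z else M z

    nbhd-G─v : ∀ a z → Nbhd G─v (member a false) z ≡ predictedNbhd (XG─v a) (not a ∧ pu) false z
    nbhd-G─v a z = byMembership z (nbhd-on-W G─v a false (XG─v a) _ _ z) λ Wz →
      trans (nbhd-via G─v a false z (anyEdge-inside G─v W W⊆G─v z)) (atVertex inG─v predictG─v lawG─v a false z Wz)

    XG─u : Bool → Subset n
    XG─u b z = if b then M z ∨ B z else M z

    nbhd-G─u : ∀ b z → Nbhd G─u (member false b) z ≡ predictedNbhd (XG─u b) false (not b ∧ pv) z
    nbhd-G─u b z = byMembership z (nbhd-on-W G─u false b (XG─u b) _ _ z) λ Wz →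
      trans (nbhd-via G─u false b z (anyEdge-inside G─u W W⊆G─u z)) (atVertex inG─u predictG─u lawG─u false b z Wz)

    nbhd-G─u─v : ∀ z → Nbhd G─u─v (member false false) z ≡ predictedNbhd M false false z
    nbhd-G─u─v z = byMembership z (nbhd-on-W G─u─v false false M _ _ z) λ Wz →
      trans (nbhd-via G─u─v false false z (anyEdge-inside G─u─v W W⊆G─u─v z))
            (atVertex inG─u─v predictG─u─v lawG─u─v false false z Wz)

    XG∖v : Bool → Subset n
    XG∖v a z = if a then M z ∨ A z else (if pv then M z ∨ B z else M z)

    nbhd-G∖v : ∀ a z → Nbhd G∖v (member a false) z ≡ predictedNbhd (XG∖v a) (not a ∧ pu) false z
    nbhd-G∖v a z = byMembership z (nbhd-on-W G∖v a false (XG∖v a) _ _ z) λ Wz →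
      trans (nbhd-via G∖v a false z (anyEdge-contraction G W v W⊆G Wv z Wz))
            (atVertex inG∖v predictG∖v lawG∖v a false z Wz)

    XG─u∖v : Subset n
    XG─u∖v z = if pv then M z ∨ B z else M z

    nbhd-G─u∖v : ∀ z → Nbhd G─u∖v (member false false) z ≡ predictedNbhd XG─u∖v false false z
    nbhd-G─u∖v z = byMembership z (nbhd-on-W G─u∖v false false XG─u∖v _ _ z) λ Wz →
      trans (nbhd-via G─u∖v false false z (anyEdge-contraction G─u W v W⊆G─u Wv z Wz))
            (atVertex inG─u∖v predictG─u∖v lawG─u∖v false false z Wz)

    XG─v∖u : Subset n
    XG─v∖u z = if pu then M z ∨ A z else M z

    nbhd-G─v∖u : ∀ z → Nbhd G─v∖u (member false false) z ≡ predictedNbhd XG─v∖u false false z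
    nbhd-G─v∖u z = byMembership z (nbhd-on-W G─v∖u false false XG─v∖u _ _ z) λ Wz →
      trans (nbhd-via G─v∖u false false z (anyEdge-contraction G─v W u W⊆G─v Wu z Wz))
            (atVertex inG─v∖u predictG─v∖u lawG─v∖u false false z Wz)

    XG─N[u] : Subset n
    XG─N[u] z = M z ∧ not (adj G u z)

    -- If W reaches u, it meets N[u] and so is not inside G − N[u].
    reached : pu ≡ true → ∃ λ w → W w ≡ true × V G─N[u] w ≡ false
    reached h with anyF-witness n (λ w → W w ∧ adj G w u) h
    ... | w , w~u with W w in Ww
    ...   | true = w , Ww , absent (V G w) (trans (cong ((V G w ∧ (w == u)) ∨_) u~w) (BoolP.∨-zeroʳ _))
      where
      u~w : E G u w ≡ true
      u~w = both Vu (both (W⊆G w Ww) (trans (adj-sym G u w) w~u))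

    module Unreached (unreached : pu ≡ false) where

      u≁W : ∀ w → W w ≡ true → adj G u w ≡ false
      u≁W w Ww with adj G u w in u~w
      ... | false = refl
      ... | true with trans (sym (anyF-intro n (λ w′ → W w′ ∧ adj G w′ u) w
                                  (subst (λ t → t ∧ adj G w u ≡ true) (sym Ww) (trans (adj-sym G w u) u~w)))) unreached
      ...   | ()

      W⊆G─N[u] : W ⊆V G─N[u]
      W⊆G─N[u] = ⊆V-delete G (N[ u ] G) W W⊆G outside-N[u]
        where
        outside-N[u] : ∀ w → W w ≡ true → (N[ u ] G) w ≡ false
        outside-N[u] w Ww rewrite W⊆G w Ww | ≢⇒== (separated {P = W} Ww Wu) | u≁W w Ww = BoolP.∧-zeroʳ (V G u)

      nbhd-G─N[u] : ∀ z → Nbhd G─N[u] (member false false) z ≡ predictedNbhd XG─N[u] false false z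
      nbhd-G─N[u] z = byMembership z (nbhd-on-W G─N[u] false false XG─N[u] _ _ z) λ Wz →
        trans (nbhd-via G─N[u] false false z (anyEdge-inside G─N[u] W W⊆G─N[u] z))
              (atVertex inG─N[u] predictG─N[u] lawG─N[u] false false z Wz)

      count-split : count n (outside (λ z → M z ∨ A z)) ≡ (deg G u ∸ 1) + count n (outside XG─N[u])
      count-split = begin
        count n (outside (λ z → M z ∨ A z))
          ≡⟨ count-cong n (λ z → split-law (W z) (off-uv z) (V G z) (adjacentTo G W z) (adj G u z) (W≁u z)) ⟩
        count n (λ z → outside XG─N[u] z ∨ (off-uv z ∧ A z))
          ≡⟨ count-∨ n _ _ (λ z → split-disjoint (W z) (off-uv z) (V G z) (adjacentTo G W z) (adj G u z)) ⟩
        count n (outside XG─N[u]) + count n (λ z → off-uv z ∧ A z)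
          ≡⟨ +-comm (count n (outside XG─N[u])) _ ⟩
        count n (λ z → off-uv z ∧ A z) + count n (outside XG─N[u])
          ≡⟨ cong (λ d → d ∸ 1 + count n (outside XG─N[u])) degree ⟨
        (deg G u ∸ 1) + count n (outside XG─N[u]) ∎
        where
        open ≡-Reasoning
        W≁u : ∀ z → (W z ∧ adj G u z) ≡ false
        W≁u z = byMembership z (λ Wz → trans (cong (_∧ adj G u z) Wz) (u≁W z Wz)) (λ Wz → cong (_∧ adj G u z) Wz)

module Recurrence {c ℓ : Level} (R : CommutativeRing c ℓ) (x y : CommutativeRing.Carrier R)
  {n : ℕ} (G : Graph n) (u v : Fin n) (Vu : V G u ≡ true) (Vv : V G v ≡ true) (Euv : E G u v ≡ true)
  (dom : ∀ z → V G z ≡ true → (z ≡ v ⊎ E G v z ≡ true) → (z ≡ u ⊎ E G u z ≡ true)) where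

  open CommutativeRing R hiding (zero)
  import Data.Nat as ℕ
  open import Data.Bool using (false; _∧_; _∨_; not; if_then_else_)
  open import Data.Product using (_,_)
  import Relation.Binary.PropositionalEquality as ≡
  open import Relation.Binary.Reasoning.Setoid setoid
  open FiniteSets
  open SubsetSums R
  open Neighbourhoods using (_⊆V_)
  open DominatedPair G u v Vu Vv Euv dom
  open RecurrenceAlgebra R x y (deg G u ∸ 1)

  weight : Graph n → Subset n → Carrier
  weight H W = if allF n (λ z → not (W z) ∨ V H z) then pow R x (count n W) * pow R y (count n (Nbhd H W)) else 0#

  weight-ext : ∀ H → Extensional (weight H)
  weight-ext H W W′ W≗W′ =
    ≡.cong₂ (λ s t → if s then t else 0#) (allF-cong n (λ z → ≡.cong (λ t → not t ∨ V H z) (W≗W′ z)))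
      (≡.cong₂ (λ k m → pow R x k * pow R y m) (count-cong n W≗W′)
         (count-cong n (λ z → ≡.cong₂ (λ s t → V H z ∧ (not s ∧ t)) (W≗W′ z)
                                        (anyF-cong n (λ w → ≡.cong (_∧ E H w z) (W≗W′ w))))))

  weight-inside : ∀ H W {k m} → W ⊆V H → count n W ≡ k → count n (Nbhd H W) ≡ m → weight H W ≡ pow R x k * pow R y m
  weight-inside H W W⊆H |W| |N| =
    ≡.trans (≡.cong (λ b → if b then pow R x (count n W) * pow R y (count n (Nbhd H W)) else 0#)
                    (allF-intro n _ (λ z → inside (W z) (W⊆H z))))
            (≡.cong₂ (λ k m → pow R x k * pow R y m) |W| |N|)
    where
    inside : ∀ {Vz} b → (b ≡ true → Vz ≡ true) → not b ∨ Vz ≡ true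
    inside true  h = h ≡.refl
    inside false h = ≡.refl

  weight-outside : ∀ H W p → W p ≡ true → V H p ≡ false → weight H W ≡ 0#
  weight-outside H W p Wp Hp =
    ≡.cong (λ b → if b then pow R x (count n W) * pow R y (count n (Nbhd H W)) else 0#)
           (allF-refute n _ p (≡.trans (≡.cong (λ t → not t ∨ V H p) Wp) Hp))

  Ψ : (Subset n → Carrier) → Subset n → Carrier
  Ψ f = pairSum u (pairSum v f)

  Σ-Ψ : ∀ f → Extensional f → Σ f ≈ Σ (Ψ f)
  Σ-Ψ f f-ext = trans (Σ-pairSum v f f-ext) (Σ-pairSum u (pairSum v f) (pairSum-ext v f f-ext))

  Ψ-at-u : ∀ f W → W u ≡ true → Ψ f W ≈ 0#
  Ψ-at-u f W Wu = reflexive (≡.cong (if_then 0# else (pairSum v f (W [ u ≔ false ]) + pairSum v f (W [ u ≔ true ]))) Wu)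

  Ψ-at-v : ∀ f W → W u ≡ false → W v ≡ true → Ψ f W ≈ 0#
  Ψ-at-v f W Wu Wv =
    trans (reflexive (≡.trans (≡.cong (if_then 0# else (pairSum v f (W [ u ≔ false ]) + pairSum v f (W [ u ≔ true ]))) Wu)
                        (≡.cong₂ _+_ (at false) (at true))))
          (+-identityʳ 0#)
    where
    at : ∀ a → pairSum v f (W [ u ≔ a ]) ≡ 0#
    at a = ≡.cong (if_then 0# else (f ((W [ u ≔ a ]) [ v ≔ false ]) + f ((W [ u ≔ a ]) [ v ≔ true ])))
                  (≡.trans (update-≢ W u a v (λ v≡u → u≢v (≡.sym v≡u))) Wv)

  Ψ-fibre : ∀ f W → W u ≡ false → W v ≡ false → ∀ {t₀₀ t₀₁ t₁₀ t₁₁} →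
    f ((W [ u ≔ false ]) [ v ≔ false ]) ≡ t₀₀ → f ((W [ u ≔ false ]) [ v ≔ true ]) ≡ t₀₁ →
    f ((W [ u ≔ true ]) [ v ≔ false ]) ≡ t₁₀ → f ((W [ u ≔ true ]) [ v ≔ true ]) ≡ t₁₁ →
    Ψ f W ≡ (t₀₀ + t₀₁) + (t₁₀ + t₁₁)
  Ψ-fibre f W Wu Wv e₀₀ e₀₁ e₁₀ e₁₁ =
    ≡.trans (≡.cong (if_then 0# else (pairSum v f (W [ u ≔ false ]) + pairSum v f (W [ u ≔ true ]))) Wu)
            (≡.cong₂ _+_ (at false e₀₀ e₀₁) (at true e₁₀ e₁₁))
    where
    at : ∀ a {s t} → f ((W [ u ≔ a ]) [ v ≔ false ]) ≡ s → f ((W [ u ≔ a ]) [ v ≔ true ]) ≡ t →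
         pairSum v f (W [ u ≔ a ]) ≡ s + t
    at a e₀ e₁ = ≡.trans (≡.cong (if_then 0# else (f ((W [ u ≔ a ]) [ v ≔ false ]) + f ((W [ u ≔ a ]) [ v ≔ true ])))
                                 (≡.trans (update-≢ W u a v (λ v≡u → u≢v (≡.sym v≡u))) Wv))
                         (≡.cong₂ _+_ e₀ e₁)

  Ψ-outside : ∀ H W z → W u ≡ false → W v ≡ false → W z ≡ true → V H z ≡ false → Ψ (weight H) W ≈ 0#
  Ψ-outside H W z Wu Wv Wz Hz =
    trans (reflexive (Ψ-fibre (weight H) W Wu Wv (gone false false) (gone false true) (gone true false) (gone true true)))
          (trans (+-cong (+-identityʳ 0#) (+-identityʳ 0#)) (+-identityʳ 0#))
    where
    gone : ∀ a b → weight H ((W [ u ≔ a ]) [ v ≔ b ]) ≡ 0#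
    gone a b = weight-outside H _ z (≡.trans (update-≢ (W [ u ≔ a ]) v b z (separated {P = W} Wz Wv))
                                      (≡.trans (update-≢ W u a z (separated {P = W} Wz Wu)) Wz)) Hz

  rhs : (Graph n → Carrier) → Carrier
  rhs T = combo (T G─v) (T G─u─v) (T G─u) (T G∖v) (T G─u∖v) (T G─v∖u) (T G─N[u])

  rhs-cong : ∀ {T T′ : Graph n → Carrier} → (∀ H → T H ≈ T′ H) → rhs T ≈ rhs T′
  rhs-cong e = combo-cong (e G─v) (e G─u─v) (e G─u) (e G∖v) (e G─u∖v) (e G─v∖u) (e G─N[u])

  Σ-rhs : ∀ (g : Graph n → Subset n → Carrier) → Σ (λ W → rhs (λ H → g H W)) ≈ rhs (λ H → Σ (g H))
  Σ-rhs g =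
    trans (Σ-+ {n} _ _) (+-cong
      (trans (Σ-+ {n} _ _) (+-cong
        (trans (Σ-+ {n} _ _) (+-cong
          (trans (Σ-+ {n} _ _) (+-cong (Σ-* (x + y) (g G─v)) (trans (Σ-neg {n} _) (-‿cong (Σ-* (y * (x + y)) (g G─u─v))))))
          (Σ-* y (g G─u))))
        (trans (Σ-* {n} (1# + - y) _) (*-cong refl
          (trans (Σ-+ {n} _ _) (+-cong
            (trans (Σ-+ {n} _ _) (+-cong refl (trans (Σ-neg {n} _) (-‿cong (Σ-* y (g G─u∖v))))))
            (trans (Σ-neg {n} _) (-‿cong (Σ-* x (g G─v∖u))))))))))
      (trans (Σ-neg {n} _) (-‿cong (Σ-* (x * (1# + - y) * q) (g G─N[u])))))

  module FibreSums (W : Subset n) (Wu : W u ≡ false) (Wv : W v ≡ false) (W⊆G : W ⊆V G) where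
    open Fibre W Wu Wv W⊆G

    k m ma mb mn : ℕ
    k  = count n W
    m  = count n (outside M)
    ma = count n (outside (λ z → M z ∨ A z))
    mb = count n (outside (λ z → M z ∨ B z))
    mn = count n (outside XG─N[u])

    term : ∀ H a b → member a b ⊆V H → ∀ {m′} → count n (Nbhd H (member a b)) ≡ m′ →
           weight H (member a b) ≡ pow R x (bit b ℕ.+ (bit a ℕ.+ k)) * pow R y m′
    term H a b sub = weight-inside H (member a b) sub (count-member a b)

    predicted : ∀ H a b X cu cv → (∀ z → Nbhd H (member a b) z ≡ predictedNbhd X cu cv z) →
                count n (Nbhd H (member a b)) ≡ bit cv ℕ.+ (bit cu ℕ.+ count n (outside X))
    predicted H a b X cu cv nb = ≡.trans (count-cong n nb) (count-predicted X cu cv)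

    without-u : ∀ H b → V H u ≡ false → weight H (member true b) ≡ 0#
    without-u H b u∉H = weight-outside H _ u (u∈member b) u∉H

    without-v : ∀ H a → V H v ≡ false → weight H (member a true) ≡ 0#
    without-v H a v∉H = weight-outside H _ v (v∈member a) v∉H

    X : Carrier
    X = pow R x k

    Y : ℕ → Carrier
    Y = pow R y

    fibre-G : Ψ (weight G) W ≡ (X * Y (bit pv ℕ.+ (bit pu ℕ.+ m)) + pow R x (ℕ.suc k) * Y (ℕ.suc mb))
                               + (pow R x (ℕ.suc k) * Y (ℕ.suc ma) + pow R x (ℕ.suc (ℕ.suc k)) * Y ma)
    fibre-G = Ψ-fibre (weight G) W Wu Wv (in-G false false) (in-G false true) (in-G true false) (in-G true true)
      where
      in-G : ∀ a b → weight G (member a b) ≡ pow R x (bit b ℕ.+ (bit a ℕ.+ k))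
                     * Y (bit (not b ∧ (a ∨ pv)) ℕ.+ (bit (not a ∧ (b ∨ pu)) ℕ.+ count n (outside (XG a b))))
      in-G a b = term G a b (member-⊆ G a b (λ _ → Vu) (λ _ → Vv) W⊆G) (predicted G a b (XG a b) _ _ (nbhd-G a b))

    fibre-G─v : Ψ (weight G─v) W ≡ (X * Y (bit pu ℕ.+ m) + 0#) + (pow R x (ℕ.suc k) * Y ma + 0#)
    fibre-G─v = Ψ-fibre (weight G─v) W Wu Wv (in-G─v false) (without-v G─v false v∉G─v) (in-G─v true) (without-v G─v true v∉G─v)
      where
      in-G─v : ∀ a → weight G─v (member a false) ≡ pow R x (bit a ℕ.+ k) * Y (bit (not a ∧ pu) ℕ.+ count n (outside (XG─v a)))
      in-G─v a = term G─v a false (member-⊆ G─v a false (λ _ → u∈G─v) (λ ()) W⊆G─v)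
                                  (predicted G─v a false (XG─v a) _ _ (nbhd-G─v a))

    fibre-G─u─v : Ψ (weight G─u─v) W ≡ (X * Y m + 0#) + (0# + 0#)
    fibre-G─u─v = Ψ-fibre (weight G─u─v) W Wu Wv
      (term G─u─v false false (member-⊆ G─u─v false false (λ ()) (λ ()) W⊆G─u─v)
                              (predicted G─u─v false false M _ _ nbhd-G─u─v))
      (without-v G─u─v false v∉G─u─v) (without-u G─u─v false u∉G─u─v) (without-u G─u─v true u∉G─u─v)

    fibre-G─u : Ψ (weight G─u) W ≡ (X * Y (bit pv ℕ.+ m) + pow R x (ℕ.suc k) * Y mb) + (0# + 0#)
    fibre-G─u = Ψ-fibre (weight G─u) W Wu Wv (in-G─u false) (in-G─u true) (without-u G─u false u∉G─u) (without-u G─u true u∉G─u)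
      where
      in-G─u : ∀ b → weight G─u (member false b) ≡ pow R x (bit b ℕ.+ k) * Y (bit (not b ∧ pv) ℕ.+ count n (outside (XG─u b)))
      in-G─u b = term G─u false b (member-⊆ G─u false b (λ ()) (λ _ → v∈G─u) W⊆G─u)
                                  (predicted G─u false b (XG─u b) _ _ (nbhd-G─u b))

    fibre-G∖v : Ψ (weight G∖v) W ≡ (X * Y (bit pu ℕ.+ (if pv then mb else m)) + 0#) + (pow R x (ℕ.suc k) * Y ma + 0#)
    fibre-G∖v = Ψ-fibre (weight G∖v) W Wu Wv
      (term G∖v false false (member-⊆ G∖v false false (λ ()) (λ ()) W⊆G∖v)
            (≡.trans (predicted G∖v false false (XG∖v false) _ _ (nbhd-G∖v false))
                     (≡.cong (bit pu ℕ.+_) (count-outside-if pv _ M))))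
      (without-v G∖v false v∉G∖v)
      (term G∖v true false (member-⊆ G∖v true false (λ _ → u∈G─v) (λ ()) W⊆G∖v)
            (predicted G∖v true false (XG∖v true) _ _ (nbhd-G∖v true)))
      (without-v G∖v true v∉G∖v)

    fibre-G─u∖v : Ψ (weight G─u∖v) W ≡ (X * Y (if pv then mb else m) + 0#) + (0# + 0#)
    fibre-G─u∖v = Ψ-fibre (weight G─u∖v) W Wu Wv
      (term G─u∖v false false (member-⊆ G─u∖v false false (λ ()) (λ ()) W⊆G─u∖v)
            (≡.trans (predicted G─u∖v false false XG─u∖v _ _ nbhd-G─u∖v) (count-outside-if pv _ M)))
      (without-v G─u∖v false v∉G─u∖v) (without-u G─u∖v false u∉G─u∖v) (without-u G─u∖v true u∉G─u∖v)

    fibre-G─v∖u : Ψ (weight G─v∖u) W ≡ (X * Y (if pu then ma else m) + 0#) + (0# + 0#)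
    fibre-G─v∖u = Ψ-fibre (weight G─v∖u) W Wu Wv
      (term G─v∖u false false (member-⊆ G─v∖u false false (λ ()) (λ ()) W⊆G─v∖u)
            (≡.trans (predicted G─v∖u false false XG─v∖u _ _ nbhd-G─v∖u) (count-outside-if pu _ M)))
      (without-v G─v∖u false v∉G─v∖u) (without-u G─v∖u false u∉G─v∖u) (without-u G─v∖u true u∉G─v∖u)

    fibre-G─N[u] : Ψ (weight G─N[u]) W ≡ ((if pu then 0# else X * Y mn) + 0#) + (0# + 0#)
    fibre-G─N[u] = Ψ-fibre (weight G─N[u]) W Wu Wv (by-reach pu ≡.refl)
      (without-v G─N[u] false v∉G─N[u]) (without-u G─N[u] false u∉G─N[u]) (without-u G─N[u] true u∉G─N[u])
      where
      by-reach : ∀ b → pu ≡ b → weight G─N[u] (member false false) ≡ (if b then 0# else X * Y mn)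
      by-reach true  reach with reached reach
      ... | w , Ww , w∉ = weight-outside G─N[u] _ w (member-W false false w Ww) w∉
      by-reach false unreached = term G─N[u] false false (member-⊆ G─N[u] false false (λ ()) (λ ()) W⊆G─N[u])
                                      (predicted G─N[u] false false XG─N[u] _ _ nbhd-G─N[u])
        where open Unreached unreached

    recurrence : Ψ (weight G) W ≈ rhs (λ H → Ψ (weight H) W)
    recurrence = begin
      Ψ (weight G) W                 ≡⟨ fibre-G ⟩
      _                              ≈⟨ fibre-identity pu pv pv⇒pu k m ma mb mn (λ unreached → Unreached.count-split unreached) ⟩
      _                              ≈⟨ combo-cong (reflexive fibre-G─v) (reflexive fibre-G─u─v) (reflexive fibre-G─u) (reflexive fibre-G∖v)
                                                   (reflexive fibre-G─u∖v) (reflexive fibre-G─v∖u) (reflexive fibre-G─N[u]) ⟨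
      rhs (λ H → Ψ (weight H) W)     ∎

  Shrinks : Graph n → Set
  Shrinks H = ∀ z → V H z ≡ true → V G z ≡ true

  left : ∀ {a b} → a ∧ b ≡ true → a ≡ true
  left {true} _ = ≡.refl

  rhs-on-shrinks : ∀ {T T′ : Graph n → Carrier} → (∀ H → Shrinks H → T H ≈ T′ H) → rhs T ≈ rhs T′
  rhs-on-shrinks e = combo-cong (e G─v (λ _ → left)) (e G─u─v (λ _ h → left (left h))) (e G─u (λ _ → left))
                                (e G∖v (λ _ → left)) (e G─u∖v (λ _ h → left (left h))) (e G─v∖u (λ _ h → left (left h)))
                                (e G─N[u] (λ _ → left))

  vanishing : ∀ W → (∀ H → Shrinks H → Ψ (weight H) W ≈ 0#) → Ψ (weight G) W ≈ rhs (λ H → Ψ (weight H) W)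
  vanishing W zero = trans (zero G (λ _ h → h)) (trans (sym combo-zero) (sym (rhs-on-shrinks zero)))

  fibre-recurrence : ∀ W → Ψ (weight G) W ≈ rhs (λ H → Ψ (weight H) W)
  fibre-recurrence W = by-cases (W u) ≡.refl (W v) ≡.refl (allF n (λ z → not (W z) ∨ V G z)) ≡.refl
    where
    by-cases : ∀ a → W u ≡ a → ∀ b → W v ≡ b → ∀ c → allF n (λ z → not (W z) ∨ V G z) ≡ c →
               Ψ (weight G) W ≈ rhs (λ H → Ψ (weight H) W)
    by-cases true  Wu _     _  _     _  = vanishing W (λ H _ → Ψ-at-u (weight H) W Wu)
    by-cases false Wu true  Wv _     _  = vanishing W (λ H _ → Ψ-at-v (weight H) W Wu Wv)
    by-cases false Wu false Wv true  W⊆ = FibreSums.recurrence W Wu Wv (λ z → inside (allF-elim n _ W⊆ z))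
      where
      inside : ∀ {a b} → not a ∨ b ≡ true → a ≡ true → b ≡ true
      inside {true} h ≡.refl = h
    by-cases false Wu false Wv false W⊈ with allF-counterexample n _ W⊈
    ... | z , z-outside = vanishing W (λ H shrinks → Ψ-outside H W z Wu Wv (in-W z-outside) (missing H shrinks))
      where
      in-W : ∀ {a b} → not a ∨ b ≡ false → a ≡ true
      in-W {true} _ = ≡.refl
      not-in-G : ∀ {a b} → not a ∨ b ≡ false → b ≡ false
      not-in-G {true} h = h
      missing : ∀ H → Shrinks H → V H z ≡ false
      missing H shrinks with V H z in Hz
      ... | true  = ≡.trans (≡.sym (shrinks z Hz)) (not-in-G z-outside)
      ... | false = ≡.refl

  theorem : J R G x y ≈ rhs (λ H → J R H x y)
  theorem = begin
    Σ (weight G)                           ≈⟨ Σ-Ψ (weight G) (weight-ext G) ⟩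
    Σ (Ψ (weight G))                       ≈⟨ Σ-cong fibre-recurrence ⟩
    Σ (λ W → rhs (λ H → Ψ (weight H) W))   ≈⟨ Σ-rhs (λ H → Ψ (weight H)) ⟩
    rhs (λ H → Σ (Ψ (weight H)))           ≈⟨ rhs-cong (λ H → Σ-Ψ (weight H) (weight-ext H)) ⟨
    rhs (λ H → Σ (weight H))               ∎

theorem1 : ∀ {c ℓ : Level} (R : CommutativeRing c ℓ) (x y : CommutativeRing.Carrier R)
           {n : ℕ} (G : Graph n) (u v : Fin n)
           → V G u ≡ true → V G v ≡ true → E G u v ≡ true
           → (∀ z → V G z ≡ true → (z ≡ v ⊎ E G v z ≡ true) → (z ≡ u ⊎ E G u z ≡ true))
           → let open CommutativeRing R
                 J' = λ (H : Graph n) → J R H x y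
             in J' G ≈ (((((x + y) * J' (G ─ ⟦ v ⟧)
                        + - (y * (x + y) * J' ((G ─ ⟦ u ⟧) ─ ⟦ v ⟧)))
                        + y * J' (G ─ ⟦ u ⟧))
                        + (1# + - y) * ((J' (G ∖ v) + - (y * J' ((G ─ ⟦ u ⟧) ∖ v)))
                                        + - (x * J' ((G ─ ⟦ v ⟧) ∖ u))))
                        + - (x * (1# + - y) * pow R y (deg G u ∸ 1) * J' (G ─ (N[ u ] G))))
theorem1 R x y G u v Vu Vv Euv dom = Recurrence.theorem R x y G u v Vu Vv Euv dom
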